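{- Let $G\in\mathcal{U}(N,k)$ with cycle $C$, let $x\sim u\sim y$ be consecutive vertices of $C$, and let $v$ be a vertex not on $C$ with $u\sim v$ and $d(v)\ge 3$. Write $N(u)=\{x,y,v\}\cup\{u_1,\dots,u_n\}$ ($n\ge 0$) and $N(v)=\{u\}\cup\{v_1,\dots,v_m\}$. Let $T^*$ be the connected component containing $v$ of the graph obtained from $G$ by deleting the edge $uv$ (a tree), and assume that $v$ is the only vertex of $T^*$ of degree at least $3$. Then: (a) if $d(u)\ge d(v)$ and $G^*$ is obtained from $G$ by deleting the edges $vv_i$ and adding the edges $uv_i$ for all $2\le i\le m$, then $SO(G^*)>SO(G)$; (b) if $d(v)>d(u)$ and $G^*$ is obtained from $G$ by deleting the edges $uu_i$ ($1\le i\le n$) and $ux$ and adding the edges $vu_i$ ($1\le i\le n$) and $vx$, then $SO(G^*)>SO(G)$.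
   Context: All graphs are finite, simple and connected. For a graph $G$ with vertex degrees $d(\cdot)$, the Sombor index is $SO(G)=\sum_{ab\in E(G)}\sqrt{d(a)^2+d(b)^2}$. $N(a)$ denotes the set of neighbours of $a$. A pendant vertex is a vertex of degree $1$. $\mathcal{U}(N,k)$ is the class of connected unicyclic graphs (exactly one cycle) on $N$ vertices with exactly $k$ pendant vertices. -}

module Defs where

open import Data.Nat as ℕ using (ℕ; zero; suc; s≤s)
open import Data.Nat.Properties using ()
open import Data.Fin as Fin using (Fin; toℕ; fromℕ<)
open import Data.Bool using (Bool; true; false; if_then_else_; _∧_; _∨_; not)
open import Data.List using (List; []; _∷_; [_]; map; concatMap; foldr)
open import Data.Nat.ListAction renaming (sum to sumℕ)
open import Data.List.Relation.Binary.Pointwise using (Pointwise)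
open import Data.Product using (Σ; ∃; ∃-syntax; _×_; _,_)
open import Data.Sum using (_⊎_)
open import Data.Integer using (+_)
open import Data.Rational as ℚ using (ℚ; 0ℚ; _/_)
open import Relation.Binary.PropositionalEquality using (_≡_; _≢_)
open import Relation.Nullary using (does; yes; no)
open import Function.Definitions using (Injective)

record Graph (n : ℕ) : Set where
  field
    adj    : Fin n → Fin n → Bool
    sym    : ∀ a b → adj a b ≡ adj b a
    irrefl : ∀ a → adj a a ≡ false
open Graph public

_==_ : ∀ {n} → Fin n → Fin n → Bool
a == b = does (a Fin.≟ b)

b2n : Bool → ℕ
b2n true  = 1
b2n false = 0

deg : ∀ {n} → Graph n → Fin n → ℕ
deg {n} G a = sumℕ (map (λ b → b2n (adj G a b)) (Data.List.allFin n))

pendants : ∀ {n} → Graph n → ℕ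
pendants {n} G = sumℕ (map (λ a → b2n (deg G a ℕ.≡ᵇ 1)) (Data.List.allFin n))

data Reach {n : ℕ} (R : Fin n → Fin n → Bool) : Fin n → Fin n → Set where
  here : ∀ {a} → Reach R a a
  step : ∀ {a c b} → R a c ≡ true → Reach R c b → Reach R a b

Connected : ∀ {n} → Graph n → Set
Connected G = ∀ a b → Reach (adj G) a b

next : ∀ {L} → Fin L → Fin L
next {suc L} i with toℕ i ℕ.<? L
... | yes p = fromℕ< (s≤s p)
... | no _  = Fin.zero

record IsCycle {n : ℕ} (G : Graph n) (L : ℕ) (c : Fin L → Fin n) : Set where
  field
    len≥3    : 3 ℕ.≤ L
    distinct : Injective _≡_ _≡_ c
    closed   : ∀ i → adj G (c i) (c (next i)) ≡ true

CycEdge : ∀ {n L} → (Fin L → Fin n) → Fin n → Fin n → Set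
CycEdge c a b = ∃[ i ] ((c i ≡ a × c (next i) ≡ b) ⊎ (c i ≡ b × c (next i) ≡ a))

-- G is unicyclic with cycle c: connected, c is a cycle, and every cycle of G
-- equals c (as a subgraph, i.e. has the same edge set)
UnicyclicWith : ∀ {n} → Graph n → (L : ℕ) → (Fin L → Fin n) → Set
UnicyclicWith {n} G L c =
  Connected G × IsCycle G L c ×
  (∀ L′ (c′ : Fin L′ → Fin n) → IsCycle G L′ c′ →
     ∀ a b → (CycEdge c a b → CycEdge c′ a b) × (CycEdge c′ a b → CycEdge c a b))

InU : (N k : ℕ) → Graph N → (L : ℕ) → (Fin L → Fin N) → Set
InU N k G L c = UnicyclicWith G L c × pendants G ≡ k

-- SO(G) = Σ_{ab ∈ E} √(d(a)² + d(b)²).  Since there are no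
-- reals, we record the list of radicands d(a)² + d(b)² (one per edge) and
-- compare sums of square roots exactly via rational bounds.

edges : ∀ {n} → Graph n → List (Fin n × Fin n)
edges {n} G = concatMap (λ a → concatMap (λ b →
    if adj G a b ∧ (toℕ a ℕ.<ᵇ toℕ b) then [ (a , b) ] else [])
  (Data.List.allFin n)) (Data.List.allFin n)

radicands : ∀ {n} → Graph n → List ℕ
radicands G = map (λ { (a , b) → deg G a ℕ.* deg G a ℕ.+ deg G b ℕ.* deg G b }) (edges G)

toℚ : ℕ → ℚ
toℚ m = (+ m) / 1

sumℚ : List ℚ → ℚ
sumℚ = foldr ℚ._+_ 0ℚ

-- Σ √xs < Σ √ys  (exact, for lists of naturals):
-- there are rationals s_i ≥ √x_i and 0 ≤ r_j ≤ √y_j with Σ s < Σ r.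
SqrtSum< : List ℕ → List ℕ → Set
SqrtSum< xs ys = ∃[ ss ] ∃[ rs ]
  ( Pointwise (λ s x → (0ℚ ℚ.≤ s) × (toℚ x ℚ.≤ s ℚ.* s)) ss xs
  × Pointwise (λ r y → (0ℚ ℚ.≤ r) × (r ℚ.* r ℚ.≤ toℚ y)) rs ys
  × sumℚ ss ℚ.< sumℚ rs )

SO< : ∀ {n} → Graph n → Graph n → Set
SO< G H = SqrtSum< (radicands G) (radicands H)

delEdge : ∀ {n} → Graph n → Fin n → Fin n → Fin n → Fin n → Bool
delEdge G u v a b = adj G a b ∧ not ((a == u ∧ b == v) ∨ (a == v ∧ b == u))

-- (a): v_i (i ≥ 2) = neighbours of v other than u and v₁
isVi : ∀ {n} → Graph n → (u v v₁ : Fin n) → Fin n → Bool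
isVi G u v v₁ w = adj G v w ∧ not (w == u) ∧ not (w == v₁)

specA : ∀ {n} → Graph n → (u v v₁ : Fin n) → Fin n → Fin n → Bool
specA G u v v₁ a b =
  (adj G a b ∧ not ((a == v ∧ isVi G u v v₁ b) ∨ (b == v ∧ isVi G u v v₁ a)))
  ∨ (a == u ∧ isVi G u v v₁ b) ∨ (b == u ∧ isVi G u v v₁ a)

-- (b): u_1, …, u_n together with x = neighbours of u other than y and v
isUx : ∀ {n} → Graph n → (u v y : Fin n) → Fin n → Bool
isUx G u v y w = adj G u w ∧ not (w == y) ∧ not (w == v)

specB : ∀ {n} → Graph n → (u v y : Fin n) → Fin n → Fin n → Bool
specB G u v y a b =
  (adj G a b ∧ not ((a == u ∧ isUx G u v y b) ∨ (b == u ∧ isUx G u v y a)))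
  ∨ (a == v ∧ isUx G u v y b) ∨ (b == v ∧ isUx G u v y a)

module Submission where

-- Only edges at p and q change (p = v, q = u in (a); p = u, q = v in (b)): every neighbour of p
-- other than q and one kept neighbour z (v₁, resp. y) is moved to q, so d(p) drops to 2 and d(q)
-- grows by the number s of moved edges.  As v is the only branch vertex of T*, the neighbours of v
-- other than u have degree ≤ 2, and as C is the only cycle, no triangle contains uv.  So
-- SO(G*) − SO(G) is an explicit sum of differences of square roots: the edges that end at q
-- gain, the edge pq does not lose, and the loss on the edge pz is outweighed by the gain on the
-- other edges at v.  Roots are compared through ⌊K√x⌋ with K of order n³, which absorbs the
-- rounding errors (at most one unit per edge) and yields the rational bounds required by SO<.
-- When d(v) = 3 the margins are small and four-decimal bounds on √5, …, √20 are used.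

open import Data.Bool using (Bool; true; false; not; _∧_; _∨_; if_then_else_; T)
open import Data.Bool.Properties using (∧-identityʳ; ∧-zeroʳ; ∧-assoc; ∧-comm; ∧-conicalˡ)
open import Data.Empty using (⊥; ⊥-elim)
open import Data.Fin as Fin using (Fin; toℕ)
open import Data.Fin.Properties using (toℕ-injective; toℕ-fromℕ<; toℕ<n)
open import Data.Integer as ℤ using (+≤+; +<+)
open import Data.Integer.Properties using (+◃n≡+n)
open import Data.List using (List; []; _∷_; [_]; _++_; map; concatMap; allFin; tabulate)
open import Data.List.Properties using (map-++; map-∘; map-tabulate)
open import Data.List.Relation.Binary.Pointwise using (Pointwise; []; _∷_)
open import Data.Nat using (ℕ; zero; suc; _+_; _*_; _≤_; _<_; z≤n; s≤s; _≤ᵇ_; _<ᵇ_)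
open import Data.Nat.ListAction renaming (sum to sumℕ)
open import Data.Nat.ListAction.Properties using (sum-++)
open import Data.Nat.Properties
open import Data.Nat.Tactic.RingSolver using (solve-∀)
open import Data.Product using (_×_; _,_; proj₁; proj₂)
open import Data.Rational as ℚ using (ℚ; 0ℚ; toℚᵘ; fromℚᵘ)
open import Data.Rational.Properties using (toℚᵘ-fromℚᵘ; toℚᵘ-homo-*; toℚᵘ-homo-+; toℚᵘ-cancel-≤; toℚᵘ-cancel-<)
open import Data.Rational.Unnormalised as ℚᵘ using (ℚᵘ; mkℚᵘ; *≤*; *<*; *≡*)
import Data.Rational.Unnormalised.Properties as ℚᵘ
open import Data.Sum using (_⊎_; inj₁; inj₂)
open import Function using (_∘_; id)
open import Relation.Binary.PropositionalEquality hiding ([_])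
open import Relation.Nullary using (Dec; yes; no; ¬_)
open import Relation.Nullary.Decidable using (dec-true; dec-false)
open import Relation.Nullary.Negation using (contradiction)
open import Defs hiding (sym)

open import Algebra.Properties.Semiring.Sum +-*-semiring

∑-mono-≤ : ∀ {n} {f g : Fin n → ℕ} → (∀ a → f a ≤ g a) → ∑[ a < n ] f a ≤ ∑[ a < n ] g a
∑-mono-≤ {zero}  f≤g = z≤n
∑-mono-≤ {suc n} f≤g = +-mono-≤ (f≤g Fin.zero) (∑-mono-≤ (f≤g ∘ Fin.suc))

∑-const : ∀ n c → ∑[ _ < n ] c ≡ n * c
∑-const zero    c = refl
∑-const (suc n) c = cong (c +_) (∑-const n c)

∑-select : ∀ {n} (p : Fin n) (f : Fin n → ℕ) → ∑[ a < n ] (b2n (a == p) * f a) ≡ f p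
∑-select {suc n} Fin.zero f =
  trans (cong₂ _+_ (+-identityʳ (f Fin.zero)) (sum-replicate-zero n)) (+-identityʳ (f Fin.zero))
∑-select {suc n} (Fin.suc p) f = ∑-select p (f ∘ Fin.suc)

isqrt : ℕ → ℕ
isqrt zero    = zero
isqrt (suc n) = if suc (isqrt n) * suc (isqrt n) ≤ᵇ suc n then suc (isqrt n) else isqrt n

record IsFloorSqrt (n t : ℕ) : Set where
  field
    lower : t * t ≤ n
    upper : n < suc t * suc t

isqrt-correct : ∀ n → IsFloorSqrt n (isqrt n)
isqrt-correct zero = record { lower = z≤n ; upper = s≤s z≤n }
isqrt-correct (suc n) with isqrt-correct n | suc (isqrt n) * suc (isqrt n) ≤ᵇ suc n in step
... | ih | true = record
  { lower = ≤ᵇ⇒≤ _ _ (subst T (sym step) _)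
  ; upper = ≤-<-trans (IsFloorSqrt.upper ih) (*-mono-< (n<1+n (suc (isqrt n))) (n<1+n (suc (isqrt n)))) }
... | ih | false = record
  { lower = ≤-trans (IsFloorSqrt.lower ih) (n≤1+n n)
  ; upper = ≰⇒> (λ le → subst T step (≤⇒≤ᵇ le)) }

square-cancel-≤ : ∀ {a b} → a * a ≤ b * b → a ≤ b
square-cancel-≤ {a} {b} le with a ≤? b
... | yes a≤b = a≤b
... | no  a≰b = contradiction le (<⇒≱ (*-mono-< (≰⇒> a≰b) (≰⇒> a≰b)))

square-cancel-< : ∀ {a b} → a * a < b * b → a < b
square-cancel-< {a} {b} lt with a <? b
... | yes a<b = a<b
... | no  a≮b = contradiction lt (≤⇒≯ (*-mono-≤ (≮⇒≥ a≮b) (≮⇒≥ a≮b)))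

isqrt-greatest : ∀ {t n} → t * t ≤ n → t ≤ isqrt n
isqrt-greatest {t} {n} le with t ≤? isqrt n
... | yes t≤ = t≤
... | no  t≰ = contradiction (≤-trans (*-mono-≤ (≰⇒> t≰) (≰⇒> t≰)) le)
                            (<⇒≱ (IsFloorSqrt.upper (isqrt-correct n)))

isqrt-< : ∀ {t n} → n < t * t → isqrt n < t
isqrt-< {n = n} lt = square-cancel-< (≤-<-trans (IsFloorSqrt.lower (isqrt-correct n)) lt)

isqrt-mono : ∀ {x y} → x ≤ y → isqrt x ≤ isqrt y
isqrt-mono {x} le = isqrt-greatest (≤-trans (IsFloorSqrt.lower (isqrt-correct x)) le)

-- ⌊ K √ x ⌋ is kept opaque so that numerals never get unfolded inside isqrt.
opaque
  ⌊_√_⌋ : ℕ → ℕ → ℕ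
  ⌊ K √ x ⌋ = isqrt (K * K * x)

opaque
  unfolding ⌊_√_⌋

  ⌊√⌋-correct : ∀ K x → IsFloorSqrt (K * K * x) ⌊ K √ x ⌋
  ⌊√⌋-correct K x = isqrt-correct (K * K * x)

  ⌊√⌋-mono : ∀ K {x y} → x ≤ y → ⌊ K √ x ⌋ ≤ ⌊ K √ y ⌋
  ⌊√⌋-mono K le = isqrt-mono (*-monoʳ-≤ (K * K) le)

  ⌊√⌋-square : ∀ K z w → K * z ≤ ⌊ K √ (z * z + w) ⌋
  ⌊√⌋-square K z w = isqrt-greatest (subst (_≤ K * K * (z * z + w)) (square-of-product K z) (*-monoʳ-≤ (K * K) (m≤m+n (z * z) w)))
    where
    square-of-product : ∀ K z → K * K * (z * z) ≡ K * z * (K * z)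
    square-of-product = solve-∀

  ⌊√⌋-≤-ratio : ∀ K c p q → c * (q * q) ≤ p * p → q * ⌊ K √ c ⌋ ≤ K * p
  ⌊√⌋-≤-ratio K c p q le = square-cancel-≤ (begin
      q * t * (q * t)       ≡⟨ square-of-product q t ⟩
      q * q * (t * t)       ≤⟨ *-monoʳ-≤ (q * q) (IsFloorSqrt.lower (isqrt-correct (K * K * c))) ⟩
      q * q * (K * K * c)   ≡⟨ rearrange q K c ⟩
      K * K * (c * (q * q)) ≤⟨ *-monoʳ-≤ (K * K) le ⟩
      K * K * (p * p)       ≡⟨ square-of-product K p ⟨
      K * p * (K * p)       ∎)
    where
    open ≤-Reasoning
    t : ℕ
    t = isqrt (K * K * c)
    square-of-product : ∀ q t → q * t * (q * t) ≡ q * q * (t * t)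
    square-of-product = solve-∀
    rearrange : ∀ q K c → q * q * (K * K * c) ≡ K * K * (c * (q * q))
    rearrange = solve-∀

  ratio-<-⌊√⌋ : ∀ K c p q → p * p ≤ c * (suc q * suc q) → K * p < suc q * suc ⌊ K √ c ⌋
  ratio-<-⌊√⌋ K c p q le = square-cancel-< (begin-strict
      K * p * (K * p)             ≡⟨ square-of-product K p ⟩
      K * K * (p * p)             ≤⟨ *-monoʳ-≤ (K * K) le ⟩
      K * K * (c * (q′ * q′))     ≡⟨ rearrange q′ K c ⟨
      q′ * q′ * (K * K * c)       <⟨ *-monoʳ-< (q′ * q′) (IsFloorSqrt.upper (isqrt-correct (K * K * c))) ⟩
      q′ * q′ * (suc t * suc t)   ≡⟨ square-of-product q′ (suc t) ⟨
      q′ * suc t * (q′ * suc t)   ∎)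
    where
    open ≤-Reasoning
    t : ℕ
    t = isqrt (K * K * c)
    q′ : ℕ
    q′ = suc q
    square-of-product : ∀ q t → q * t * (q * t) ≡ q * q * (t * t)
    square-of-product = solve-∀
    rearrange : ∀ q K c → q * q * (K * K * c) ≡ K * K * (c * (q * q))
    rearrange = solve-∀

  ⌊√⌋-shift : ∀ K e d → ⌊ K √ ((2 + e) * (2 + e) + d) ⌋ ≤ ⌊ K √ (4 + d) ⌋ + K * e
  ⌊√⌋-shift K e d = ≤-pred (isqrt-< (begin-strict
      K * K * ((2 + e) * (2 + e) + d)                                ≡⟨ expand K e d ⟩
      K * K * (4 + d) + 2 * K * (2 * (K * e)) + K * e * (K * e)
        <⟨ +-monoˡ-< _ (+-mono-<-≤ (IsFloorSqrt.upper (isqrt-correct (K * K * (4 + d))))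
                                   (*-monoˡ-≤ (2 * (K * e)) 2K≤1+t)) ⟩
      suc t * suc t + suc t * (2 * (K * e)) + K * e * (K * e)        ≡⟨ square-of-sum (suc t) (K * e) ⟩
      (suc t + K * e) * (suc t + K * e)                               ∎))
    where
    open ≤-Reasoning
    t : ℕ
    t = isqrt (K * K * (4 + d))
    expand : ∀ K e d → K * K * ((2 + e) * (2 + e) + d) ≡ K * K * (4 + d) + 2 * K * (2 * (K * e)) + K * e * (K * e)
    expand = solve-∀
    square-of-sum : ∀ s x → s * s + s * (2 * x) + x * x ≡ (s + x) * (s + x)
    square-of-sum = solve-∀
    square-of-2K : ∀ K → K * K * 4 ≡ 2 * K * (2 * K)
    square-of-2K = solve-∀
    2K≤1+t : 2 * K ≤ suc t
    2K≤1+t = <⇒≤ (square-cancel-< (≤-<-trans (subst (_≤ K * K * (4 + d)) (square-of-2K K) (*-monoʳ-≤ (K * K) (m≤m+n 4 d)))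
                                               (IsFloorSqrt.upper (isqrt-correct (K * K * (4 + d))))))

+-* : ∀ a b → ℤ.+ a ℤ.* ℤ.+ b ≡ ℤ.+ (a * b)
+-* a b = +◃n≡+n (a * b)

-- mkℚᵘ a K′ denotes a / (K′ + 1).
module FixedDenominator (K′ : ℕ) where

  K : ℕ
  K = suc K′

  over : ℕ → ℚᵘ
  over a = mkℚᵘ (ℤ.+ a) K′

  [_/K] : ℕ → ℚ
  [ a /K] = fromℚᵘ (over a)

  toℚᵘ-[/K] : ∀ a → toℚᵘ [ a /K] ℚᵘ.≃ over a
  toℚᵘ-[/K] a = toℚᵘ-fromℚᵘ (over a)

  toℚᵘ-toℚ : ∀ x → toℚᵘ (toℚ x) ℚᵘ.≃ mkℚᵘ (ℤ.+ x) 0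
  toℚᵘ-toℚ x = toℚᵘ-fromℚᵘ (mkℚᵘ (ℤ.+ x) 0)

  toℚᵘ-square : ∀ a → toℚᵘ ([ a /K] ℚ.* [ a /K]) ℚᵘ.≃ over a ℚᵘ.* over a
  toℚᵘ-square a = ℚᵘ.≃-trans (toℚᵘ-homo-* [ a /K] [ a /K]) (ℚᵘ.*-cong (toℚᵘ-[/K] a) (toℚᵘ-[/K] a))

  [/K]-nonneg : ∀ a → 0ℚ ℚ.≤ [ a /K]
  [/K]-nonneg a = toℚᵘ-cancel-≤ (ℚᵘ.≤-respˡ-≃ (ℚᵘ.≃-sym (toℚᵘ-toℚ 0)) (ℚᵘ.≤-respʳ-≃ (ℚᵘ.≃-sym (toℚᵘ-[/K] a))
    (*≤* (subst₂ ℤ._≤_ (sym (+-* 0 K)) (sym (+-* a 1)) (+≤+ z≤n)))))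

  ≤-[/K]² : ∀ x a → K * K * x ≤ a * a → toℚ x ℚ.≤ [ a /K] ℚ.* [ a /K]
  ≤-[/K]² x a le = toℚᵘ-cancel-≤ (ℚᵘ.≤-respˡ-≃ (ℚᵘ.≃-sym (toℚᵘ-toℚ x)) (ℚᵘ.≤-respʳ-≃ (ℚᵘ.≃-sym (toℚᵘ-square a))
    (*≤* (subst₂ ℤ._≤_ (sym (+-* x (K * K))) (sym (trans (cong (ℤ._* ℤ.+ 1) (+-* a a)) (+-* (a * a) 1)))
      (+≤+ (subst₂ _≤_ (*-comm (K * K) x) (sym (*-identityʳ (a * a))) le))))))

  [/K]²-≤ : ∀ y a → a * a ≤ K * K * y → [ a /K] ℚ.* [ a /K] ℚ.≤ toℚ y
  [/K]²-≤ y a le = toℚᵘ-cancel-≤ (ℚᵘ.≤-respʳ-≃ (ℚᵘ.≃-sym (toℚᵘ-toℚ y)) (ℚᵘ.≤-respˡ-≃ (ℚᵘ.≃-sym (toℚᵘ-square a))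
    (*≤* (subst₂ ℤ._≤_ (sym (trans (cong (ℤ._* ℤ.+ 1) (+-* a a)) (+-* (a * a) 1))) (sym (+-* y (K * K)))
      (+≤+ (subst₂ _≤_ (sym (*-identityʳ (a * a))) (*-comm (K * K) y) le))))))

  over-+ : ∀ a b → (over a ℚᵘ.+ over b) ℚᵘ.≃ over (a + b)
  over-+ a b = *≡* (trans (cong (ℤ._* ℤ.+ K) (cong₂ ℤ._+_ (+-* a K) (+-* b K)))
    (trans (+-* (a * K + b * K) K) (trans (cong ℤ.+_ (common-denominator a b K)) (sym (+-* (a + b) (K * K))))))
    where
    common-denominator : ∀ a b K → (a * K + b * K) * K ≡ (a + b) * (K * K)
    common-denominator = solve-∀

  toℚᵘ-sumℚ : ∀ (f : ℕ → ℕ) xs → toℚᵘ (sumℚ (map ([_/K] ∘ f) xs)) ℚᵘ.≃ over (sumℕ (map f xs))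
  toℚᵘ-sumℚ f []       = *≡* refl
  toℚᵘ-sumℚ f (x ∷ xs) = ℚᵘ.≃-trans (toℚᵘ-homo-+ [ f x /K] (sumℚ (map ([_/K] ∘ f) xs)))
    (ℚᵘ.≃-trans (ℚᵘ.+-cong (toℚᵘ-[/K] (f x)) (toℚᵘ-sumℚ f xs)) (over-+ (f x) (sumℕ (map f xs))))

  sumℚ-< : ∀ (f g : ℕ → ℕ) xs ys → sumℕ (map f xs) < sumℕ (map g ys) →
           sumℚ (map ([_/K] ∘ f) xs) ℚ.< sumℚ (map ([_/K] ∘ g) ys)
  sumℚ-< f g xs ys lt = toℚᵘ-cancel-< (ℚᵘ.<-respˡ-≃ (ℚᵘ.≃-sym (toℚᵘ-sumℚ f xs)) (ℚᵘ.<-respʳ-≃ (ℚᵘ.≃-sym (toℚᵘ-sumℚ g ys))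
    (*<* (subst₂ ℤ._<_ (sym (+-* (sumℕ (map f xs)) K)) (sym (+-* (sumℕ (map g ys)) K))
      (+<+ (*-monoˡ-< K lt))))))

  upper-bounds : ∀ xs → Pointwise (λ s x → (0ℚ ℚ.≤ s) × (toℚ x ℚ.≤ s ℚ.* s))
                                 (map (λ x → [ suc ⌊ K √ x ⌋ /K]) xs) xs
  upper-bounds []       = []
  upper-bounds (x ∷ xs) =
    ([/K]-nonneg (suc ⌊ K √ x ⌋) , ≤-[/K]² x (suc ⌊ K √ x ⌋) (<⇒≤ (IsFloorSqrt.upper (⌊√⌋-correct K x)))) ∷ upper-bounds xs

  lower-bounds : ∀ ys → Pointwise (λ r y → (0ℚ ℚ.≤ r) × (r ℚ.* r ℚ.≤ toℚ y))
                                 (map (λ y → [ ⌊ K √ y ⌋ /K]) ys) ys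
  lower-bounds []       = []
  lower-bounds (y ∷ ys) =
    ([/K]-nonneg ⌊ K √ y ⌋ , [/K]²-≤ y ⌊ K √ y ⌋ (IsFloorSqrt.lower (⌊√⌋-correct K y))) ∷ lower-bounds ys

  SqrtSum<-⌊√⌋ : ∀ xs ys → sumℕ (map (λ x → suc ⌊ K √ x ⌋) xs) < sumℕ (map ⌊ K √_⌋ ys) → SqrtSum< xs ys
  SqrtSum<-⌊√⌋ xs ys lt = _ , _ , upper-bounds xs , lower-bounds ys ,
    sumℚ-< (λ x → suc ⌊ K √ x ⌋) ⌊ K √_⌋ xs ys lt

sumℕ-allFin : ∀ n (f : Fin n → ℕ) → sumℕ (map f (allFin n)) ≡ ∑[ a < n ] f a
sumℕ-allFin n f = trans (cong sumℕ (map-tabulate id f)) (go n f)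
  where
  go : ∀ n (f : Fin n → ℕ) → sumℕ (tabulate f) ≡ ∑[ a < n ] f a
  go zero    f = refl
  go (suc n) f = cong (f Fin.zero +_) (go n (f ∘ Fin.suc))

sumℕ-concatMap : ∀ {A B : Set} (h : B → ℕ) (k : A → List B) xs →
  sumℕ (map h (concatMap k xs)) ≡ sumℕ (map (λ a → sumℕ (map h (k a))) xs)
sumℕ-concatMap h k []       = refl
sumℕ-concatMap h k (x ∷ xs) = begin
  sumℕ (map h (k x ++ concatMap k xs))
    ≡⟨ cong sumℕ (map-++ h (k x) (concatMap k xs)) ⟩
  sumℕ (map h (k x) ++ map h (concatMap k xs))
    ≡⟨ sum-++ (map h (k x)) (map h (concatMap k xs)) ⟩
  sumℕ (map h (k x)) + sumℕ (map h (concatMap k xs))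
    ≡⟨ cong (sumℕ (map h (k x)) +_) (sumℕ-concatMap h k xs) ⟩
  sumℕ (map h (k x)) + sumℕ (map (λ a → sumℕ (map h (k a))) xs) ∎
  where open ≡-Reasoning

sumℕ-if : ∀ {B : Set} (h : B → ℕ) c e → sumℕ (map h (if c then [ e ] else [])) ≡ b2n c * h e
sumℕ-if h true  e = refl
sumℕ-if h false e = refl

radicand : ∀ {n} → (Fin n → ℕ) → Fin n → Fin n → ℕ
radicand d a b = d a * d a + d b * d b

orderedEdgeSum : ∀ {n} → (Fin n → Fin n → Bool) → (Fin n → ℕ) → (ℕ → ℕ) → ℕ
orderedEdgeSum {n} A d g = ∑[ a < n ] ∑[ b < n ] (b2n (A a b) * g (radicand d a b))

module _ {n} (G : Graph n) (g : ℕ → ℕ) where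

  private
    upper : Fin n → Fin n → Bool
    upper a b = adj G a b ∧ (toℕ a <ᵇ toℕ b)

    term : Fin n → Fin n → ℕ
    term a b = b2n (upper a b) * g (radicand (deg G) a b)

  sumℕ-radicands : sumℕ (map g (radicands G)) ≡ ∑[ a < n ] ∑[ b < n ] term a b
  sumℕ-radicands = begin
    sumℕ (map g (radicands G))         ≡⟨ cong sumℕ (sym (map-∘ (edges G))) ⟩
    sumℕ (map (g ∘ rad) (edges G))     ≡⟨ sumℕ-concatMap (g ∘ rad) row (allFin n) ⟩
    sumℕ (map (λ a → sumℕ (map (g ∘ rad) (row a))) (allFin n)) ≡⟨ sumℕ-allFin n _ ⟩
    ∑[ a < n ] sumℕ (map (g ∘ rad) (row a))                     ≡⟨ sum-cong-≗ rowSum ⟩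
    ∑[ a < n ] ∑[ b < n ] term a b ∎
    where
    open ≡-Reasoning
    rad : Fin n × Fin n → ℕ
    rad (a , b) = radicand (deg G) a b
    cell : Fin n → Fin n → List (Fin n × Fin n)
    cell a b = if upper a b then [ (a , b) ] else []
    row : Fin n → List (Fin n × Fin n)
    row a = concatMap (cell a) (allFin n)
    rowSum : ∀ a → sumℕ (map (g ∘ rad) (row a)) ≡ ∑[ b < n ] term a b
    rowSum a = trans (sumℕ-concatMap (g ∘ rad) (cell a) (allFin n))
      (trans (sumℕ-allFin n _) (sum-cong-≗ (λ b → sumℕ-if (g ∘ rad) (upper a b) (a , b))))

  upper+lower : ∀ a b → b2n (upper a b) + b2n (upper b a) ≡ b2n (adj G a b)
  upper+lower a b with toℕ a <ᵇ toℕ b in a<b | toℕ b <ᵇ toℕ a in b<a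
  ... | true | true = ⊥-elim (<-asym (<ᵇ⇒< (toℕ a) (toℕ b) (subst T (sym a<b) _)) (<ᵇ⇒< (toℕ b) (toℕ a) (subst T (sym b<a) _)))
  ... | true | false rewrite ∧-identityʳ (adj G a b) | ∧-zeroʳ (adj G b a) = +-identityʳ _
  ... | false | true rewrite ∧-zeroʳ (adj G a b) | ∧-identityʳ (adj G b a) = cong b2n (Graph.sym G b a)
  ... | false | false rewrite ∧-zeroʳ (adj G a b) | ∧-zeroʳ (adj G b a) =
    cong b2n (sym (trans (cong (adj G a) (sym a≡b)) (irrefl G a)))
    where
    a≡b : a ≡ b
    a≡b = toℕ-injective (≤-antisym (≮⇒≥ (λ b<a′ → subst T b<a (<⇒<ᵇ b<a′)))
                                   (≮⇒≥ (λ a<b′ → subst T a<b (<⇒<ᵇ a<b′))))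

  twice-sumℕ-radicands : 2 * sumℕ (map g (radicands G)) ≡ orderedEdgeSum (adj G) (deg G) g
  twice-sumℕ-radicands = begin
    2 * sumℕ (map g (radicands G))          ≡⟨ cong (2 *_) sumℕ-radicands ⟩
    2 * H                                    ≡⟨ cong (H +_) (+-identityʳ H) ⟩
    H + H                                    ≡⟨ cong (H +_) (∑-comm term) ⟩
    H + ∑[ a < n ] ∑[ b < n ] term b a       ≡⟨ sym (∑-distrib-+ (λ a → ∑[ b < n ] term a b) (λ a → ∑[ b < n ] term b a)) ⟩
    ∑[ a < n ] (∑[ b < n ] term a b + ∑[ b < n ] term b a)
      ≡⟨ sum-cong-≗ (λ a → sym (∑-distrib-+ (term a) (λ b → term b a))) ⟩
    ∑[ a < n ] ∑[ b < n ] (term a b + term b a) ≡⟨ sum-cong-≗ (λ a → sum-cong-≗ (both a)) ⟩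
    orderedEdgeSum (adj G) (deg G) g ∎
    where
    open ≡-Reasoning
    H : ℕ
    H = ∑[ a < n ] ∑[ b < n ] term a b
    both : ∀ a b → term a b + term b a ≡ b2n (adj G a b) * g (radicand (deg G) a b)
    both a b rewrite +-comm (deg G b * deg G b) (deg G a * deg G a) =
      trans (sym (*-distribʳ-+ (g (radicand (deg G) a b)) (b2n (upper a b)) (b2n (upper b a)))) (cong (_* g (radicand (deg G) a b)) (upper+lower a b))

==-refl : ∀ {n} (a : Fin n) → (a == a) ≡ true
==-refl a = dec-true (a Fin.≟ a) refl

==-≢ : ∀ {n} {a b : Fin n} → a ≢ b → (a == b) ≡ false
==-≢ {a = a} {b} a≢b = dec-false (a Fin.≟ b) a≢b

Symmetric : ∀ {n} → (Fin n → Fin n → ℕ) → Set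
Symmetric F = ∀ a b → F a b ≡ F b a

ZeroDiagonal : ∀ {n} → (Fin n → Fin n → ℕ) → Set
ZeroDiagonal F = ∀ a → F a a ≡ 0

module TwoPoints {n : ℕ} (p q : Fin n) (p≢q : p ≢ q) where

  off : Fin n → ℕ
  off b = b2n (not (b == p) ∧ not (b == q))

  off-≢ : ∀ {b} → b ≢ p → b ≢ q → off b ≡ 1
  off-≢ b≢p b≢q rewrite ==-≢ b≢p | ==-≢ b≢q = refl

  off≤1 : ∀ b → off b ≤ 1
  off≤1 b with b == p | b == q
  ... | true  | _     = z≤n
  ... | false | true  = z≤n
  ... | false | false = ≤-refl

  split-term : ∀ (f : Fin n → ℕ) a → f a ≡ b2n (a == p) * f a + (b2n (a == q) * f a + off a * f a)
  split-term f a with a Fin.≟ p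
  ... | yes refl rewrite ==-≢ p≢q = sym (trans (+-identityʳ _) (+-identityʳ (f p)))
  ... | no _ with a Fin.≟ q
  ...   | yes refl = sym (trans (+-identityʳ _) (+-identityʳ (f q)))
  ...   | no _     = sym (+-identityʳ (f a))

  ∑-split : ∀ (f : Fin n → ℕ) → ∑[ a < n ] f a ≡ f p + (f q + ∑[ a < n ] (off a * f a))
  ∑-split f = begin
    ∑[ a < n ] f a
      ≡⟨ sum-cong-≗ (split-term f) ⟩
    ∑[ a < n ] (b2n (a == p) * f a + (b2n (a == q) * f a + off a * f a))
      ≡⟨ ∑-distrib-+ (λ a → b2n (a == p) * f a) _ ⟩
    ∑[ a < n ] (b2n (a == p) * f a) + ∑[ a < n ] (b2n (a == q) * f a + off a * f a)
      ≡⟨ cong₂ _+_ (∑-select p f) (∑-distrib-+ (λ a → b2n (a == q) * f a) (λ a → off a * f a)) ⟩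
    f p + (∑[ a < n ] (b2n (a == q) * f a) + ∑[ a < n ] (off a * f a))
      ≡⟨ cong (λ z → f p + (z + ∑[ a < n ] (off a * f a))) (∑-select q f) ⟩
    f p + (f q + ∑[ a < n ] (off a * f a)) ∎
    where open ≡-Reasoning

  ∑off : (Fin n → ℕ) → ℕ
  ∑off f = ∑[ b < n ] (off b * f b)

  ∑off-+ : ∀ (f g : Fin n → ℕ) → ∑off (λ b → f b + g b) ≡ ∑off f + ∑off g
  ∑off-+ f g = trans (sum-cong-≗ (λ b → *-distribˡ-+ (off b) (f b) (g b)))
                     (∑-distrib-+ (λ b → off b * f b) (λ b → off b * g b))

  ∑∑-split : ∀ (F : Fin n → Fin n → ℕ) → Symmetric F → ZeroDiagonal F →
    ∑[ a < n ] ∑[ b < n ] F a b ≡ 2 * F p q + (2 * ∑off (λ b → F p b + F q b) + ∑off (λ a → ∑off (F a)))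
  ∑∑-split F sym-F diag-F = begin
    ∑[ a < n ] row a
      ≡⟨ ∑-split row ⟩
    row p + (row q + ∑off row)
      ≡⟨ cong₂ (λ x y → x + (y + ∑off row)) (∑-split (F p)) (∑-split (F q)) ⟩
    (F p p + (F p q + ∑off (F p))) + ((F q p + (F q q + ∑off (F q))) + ∑off row)
      ≡⟨ cong (λ z → (F p p + (F p q + ∑off (F p))) + ((F q p + (F q q + ∑off (F q))) + z)) column-sums ⟩
    (F p p + (F p q + ∑off (F p))) + ((F q p + (F q q + ∑off (F q))) + (∑off (F p) + (∑off (F q) + Z)))
      ≡⟨ cong₂ (λ x y → (x + (F p q + ∑off (F p))) + ((F q p + (y + ∑off (F q))) + (∑off (F p) + (∑off (F q) + Z))))
               (diag-F p) (diag-F q) ⟩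
    (0 + (F p q + ∑off (F p))) + ((F q p + (0 + ∑off (F q))) + (∑off (F p) + (∑off (F q) + Z)))
      ≡⟨ cong (λ z → (0 + (F p q + ∑off (F p))) + ((z + (0 + ∑off (F q))) + (∑off (F p) + (∑off (F q) + Z)))) (sym-F q p) ⟩
    (0 + (F p q + ∑off (F p))) + ((F p q + (0 + ∑off (F q))) + (∑off (F p) + (∑off (F q) + Z)))
      ≡⟨ collect (F p q) (∑off (F p)) (∑off (F q)) Z ⟩
    2 * F p q + (2 * (∑off (F p) + ∑off (F q)) + Z)
      ≡⟨ cong (λ z → 2 * F p q + (2 * z + Z)) (sym (∑off-+ (F p) (F q))) ⟩
    2 * F p q + (2 * ∑off (λ b → F p b + F q b) + Z) ∎
    where
    open ≡-Reasoning
    row : Fin n → ℕ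
    row a = ∑[ b < n ] F a b
    Z : ℕ
    Z = ∑off (λ a → ∑off (F a))
    column-sums : ∑off row ≡ ∑off (F p) + (∑off (F q) + Z)
    column-sums = begin
      ∑off row                                                   ≡⟨ sum-cong-≗ (λ a → cong (off a *_) (∑-split (F a))) ⟩
      ∑off (λ a → F a p + (F a q + ∑off (F a)))                  ≡⟨ ∑off-+ (λ a → F a p) _ ⟩
      ∑off (λ a → F a p) + ∑off (λ a → F a q + ∑off (F a))       ≡⟨ cong (∑off (λ a → F a p) +_) (∑off-+ (λ a → F a q) _) ⟩
      ∑off (λ a → F a p) + (∑off (λ a → F a q) + Z)
        ≡⟨ cong₂ (λ x y → x + (y + Z)) (sum-cong-≗ (λ a → cong (off a *_) (sym-F a p)))
                                       (sum-cong-≗ (λ a → cong (off a *_) (sym-F a q))) ⟩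
      ∑off (F p) + (∑off (F q) + Z)                              ∎
    collect : ∀ x y₁ y₂ z → (0 + (x + y₁)) + ((x + (0 + y₂)) + (y₁ + (y₂ + z))) ≡ 2 * x + (2 * (y₁ + y₂) + z)
    collect = solve-∀

  ∑off-*ˡ : ∀ k (f : Fin n → ℕ) → ∑off (λ b → k * f b) ≡ k * ∑off f
  ∑off-*ˡ k f = trans (sum-cong-≗ (λ b → trans (sym (*-assoc (off b) k (f b)))
                                         (trans (cong (_* f b) (*-comm (off b) k)) (*-assoc k (off b) (f b)))))
                      (sym (*-distribˡ-sum k (λ b → off b * f b)))

  ∑off-const : ∀ k → ∑off (λ _ → k) ≤ n * k
  ∑off-const k = ≤-trans (∑-mono-≤ (λ b → subst (off b * k ≤_) (*-identityˡ k) (*-monoˡ-≤ k (off≤1 b))))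
                         (≤-reflexive (∑-const n k))

  ∑off-mono : ∀ {f g : Fin n → ℕ} → (∀ b → b ≢ p → b ≢ q → f b ≤ g b) → ∑off f ≤ ∑off g
  ∑off-mono {f} {g} f≤g = ∑-mono-≤ pointwise
    where
    pointwise : ∀ b → off b * f b ≤ off b * g b
    pointwise b with b Fin.≟ p | b Fin.≟ q
    ... | yes _  | _      = z≤n
    ... | no _   | yes _  = z≤n
    ... | no b≢p | no b≢q = *-monoʳ-≤ 1 (f≤g b b≢p b≢q)

  ∑off-mono-+ : ∀ {f g : Fin n → ℕ} k → (∀ b → b ≢ p → b ≢ q → f b ≤ g b + k) → ∑off f ≤ ∑off g + n * k
  ∑off-mono-+ {f} {g} k f≤g+k = begin
    ∑off f                      ≤⟨ ∑off-mono f≤g+k ⟩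
    ∑off (λ b → g b + k)        ≡⟨ ∑off-+ g (λ _ → k) ⟩
    ∑off g + ∑off (λ _ → k)     ≤⟨ +-monoʳ-≤ (∑off g) (∑off-const k) ⟩
    ∑off g + n * k              ∎
    where open ≤-Reasoning

  -- Pairs away from p and q may lose 1 each; the rows of p and q, weighted by M, pay for that.
  compare-by-rows : (M : ℕ) (FL FR : Fin n → Fin n → ℕ) →
    Symmetric FL → ZeroDiagonal FL → Symmetric FR → ZeroDiagonal FR →
    (∀ a b → a ≢ p → a ≢ q → b ≢ p → b ≢ q → FL a b ≤ FR a b + 1) →
    (c e : Fin n → ℕ) →
    (∀ b → b ≢ p → b ≢ q → M * (FL p b + FL q b) + c b ≤ M * (FR p b + FR q b) + (M + e b)) →
    (g h : ℕ) → M * FL p q + g ≤ M * FR p q + h →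
    2 * h + 2 * (n * M + ∑off e) + M * (n * n) < 2 * g + 2 * ∑off c →
    M * (∑[ a < n ] ∑[ b < n ] FL a b) < M * (∑[ a < n ] ∑[ b < n ] FR a b)
  compare-by-rows M FL FR sym-L diag-L sym-R diag-R rest c e rows g h pq budget =
    +-cancelʳ-< (2 * g + 2 * ∑off c) _ _ (begin-strict
      M * (∑[ a < n ] ∑[ b < n ] FL a b) + (2 * g + 2 * ∑off c)
        ≡⟨ cong (λ z → M * z + (2 * g + 2 * ∑off c)) (∑∑-split FL sym-L diag-L) ⟩
      M * (2 * FL p q + (2 * YL + ZL)) + (2 * g + 2 * ∑off c)
        ≡⟨ regroup M (FL p q) YL ZL g (∑off c) ⟩
      2 * (M * FL p q + g) + 2 * (M * YL + ∑off c) + M * ZL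
        ≤⟨ +-mono-≤ (+-mono-≤ (*-monoʳ-≤ 2 pq) (*-monoʳ-≤ 2 row-sums)) (*-monoʳ-≤ M rest-sum) ⟩
      2 * (M * FR p q + h) + 2 * (M * YR + (n * M + ∑off e)) + M * (ZR + n * n)
        ≡⟨ regroup′ M (FR p q) YR ZR h (n * M + ∑off e) (n * n) ⟩
      M * (2 * FR p q + (2 * YR + ZR)) + (2 * h + 2 * (n * M + ∑off e) + M * (n * n))
        <⟨ +-monoʳ-< (M * (2 * FR p q + (2 * YR + ZR))) budget ⟩
      M * (2 * FR p q + (2 * YR + ZR)) + (2 * g + 2 * ∑off c)
        ≡⟨ cong (λ z → M * z + (2 * g + 2 * ∑off c)) (∑∑-split FR sym-R diag-R) ⟨
      M * (∑[ a < n ] ∑[ b < n ] FR a b) + (2 * g + 2 * ∑off c) ∎)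
    where
    open ≤-Reasoning
    YL YR ZL ZR : ℕ
    YL = ∑off (λ b → FL p b + FL q b)
    YR = ∑off (λ b → FR p b + FR q b)
    ZL = ∑off (λ a → ∑off (FL a))
    ZR = ∑off (λ a → ∑off (FR a))
    row-sums : M * YL + ∑off c ≤ M * YR + (n * M + ∑off e)
    row-sums = begin
      M * YL + ∑off c
        ≡⟨ cong (_+ ∑off c) (∑off-*ˡ M (λ b → FL p b + FL q b)) ⟨
      ∑off (λ b → M * (FL p b + FL q b)) + ∑off c
        ≡⟨ ∑off-+ (λ b → M * (FL p b + FL q b)) c ⟨
      ∑off (λ b → M * (FL p b + FL q b) + c b)
        ≤⟨ ∑off-mono-+ M (λ b b≢p b≢q → ≤-trans (rows b b≢p b≢q) (≤-reflexive (shuffle _ M (e b)))) ⟩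
      ∑off (λ b → M * (FR p b + FR q b) + e b) + n * M
        ≡⟨ cong (_+ n * M) (trans (∑off-+ (λ b → M * (FR p b + FR q b)) e)
                                  (cong (_+ ∑off e) (∑off-*ˡ M (λ b → FR p b + FR q b)))) ⟩
      M * YR + ∑off e + n * M
        ≡⟨ shuffle (M * YR) (n * M) (∑off e) ⟨
      M * YR + (n * M + ∑off e) ∎
      where
      shuffle : ∀ x m e → x + (m + e) ≡ x + e + m
      shuffle = solve-∀
    rest-sum : ZL ≤ ZR + n * n
    rest-sum = ∑off-mono-+ n (λ a a≢p a≢q →
      subst (∑off (FL a) ≤_) (cong (∑off (FR a) +_) (*-identityʳ n))
            (∑off-mono-+ 1 (λ b b≢p b≢q → rest a b a≢p a≢q b≢p b≢q)))
    regroup : ∀ M x y z g c → M * (2 * x + (2 * y + z)) + (2 * g + 2 * c) ≡ 2 * (M * x + g) + 2 * (M * y + c) + M * z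
    regroup = solve-∀
    regroup′ : ∀ M x y z h e w → 2 * (M * x + h) + 2 * (M * y + e) + M * (z + w) ≡ M * (2 * x + (2 * y + z)) + (2 * h + 2 * e + M * w)
    regroup′ = solve-∀

  ∑off-indicator : ∀ (P : Fin n → Bool) k → (∀ {b} → P b ≡ true → off b ≡ 1) →
    ∑off (λ b → b2n (P b) * k) ≡ (∑[ b < n ] b2n (P b)) * k
  ∑off-indicator P k P⊆off = trans (sum-cong-≗ pointwise) (sym (*-distribʳ-sum k (λ b → b2n (P b))))
    where
    pointwise : ∀ b → off b * (b2n (P b) * k) ≡ b2n (P b) * k
    pointwise b with P b in Pb
    ... | true  rewrite P⊆off Pb = +-identityʳ (k + 0)
    ... | false = *-zeroʳ (off b)

  ∑off-point : ∀ z k → z ≢ p → z ≢ q → ∑off (λ b → b2n (b == z) * k) ≡ k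
  ∑off-point z k z≢p z≢q = trans (sum-cong-≗ pointwise) (∑-select z (λ _ → k))
    where
    pointwise : ∀ b → off b * (b2n (b == z) * k) ≡ b2n (b == z) * k
    pointwise b with b Fin.≟ z
    ... | yes refl rewrite off-≢ z≢p z≢q = +-identityʳ (k + 0)
    ... | no _     = *-zeroʳ (off b)

deg-∑ : ∀ {n} (G : Graph n) a → deg G a ≡ ∑[ b < n ] b2n (adj G a b)
deg-∑ {n} G a = sumℕ-allFin n (λ b → b2n (adj G a b))

adj⇒≢ : ∀ {n} (G : Graph n) {a b} → adj G a b ≡ true → a ≢ b
adj⇒≢ G {a} a~b refl with trans (sym a~b) (irrefl G a)
... | ()

adj-sym : ∀ {n} (G : Graph n) {a b} → adj G a b ≡ true → adj G b a ≡ true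
adj-sym G {a} {b} a~b = trans (Graph.sym G b a) a~b

term≤∑ : ∀ {n} (f : Fin n → ℕ) b → f b ≤ ∑[ a < n ] f a
term≤∑ {n} f b = subst (_≤ ∑[ a < n ] f a) (∑-select b f) (∑-mono-≤ selected≤)
  where
  selected≤ : ∀ a → b2n (a == b) * f a ≤ f a
  selected≤ a with a == b
  ... | true  = ≤-reflexive (+-identityʳ (f a))
  ... | false = z≤n

deg≥1 : ∀ {n} (G : Graph n) {a b} → adj G a b ≡ true → 1 ≤ deg G a
deg≥1 G {a} {b} a~b = subst (_≤ deg G a) (cong b2n a~b)
  (subst (b2n (adj G a b) ≤_) (sym (deg-∑ G a)) (term≤∑ (λ c → b2n (adj G a c)) b))

deg≤n : ∀ {n} (G : Graph n) a → deg G a ≤ n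
deg≤n {n} G a = begin
  deg G a                              ≡⟨ deg-∑ G a ⟩
  ∑[ b < n ] b2n (adj G a b)           ≤⟨ ∑-mono-≤ (λ b → b2n≤1 (adj G a b)) ⟩
  ∑[ b < n ] 1                         ≡⟨ ∑-const n 1 ⟩
  n * 1                                ≡⟨ *-identityʳ n ⟩
  n                                    ∎
  where
  open ≤-Reasoning
  b2n≤1 : ∀ x → b2n x ≤ 1
  b2n≤1 true  = ≤-refl
  b2n≤1 false = z≤n

∑-indicator-== : ∀ {n} (c : Fin n) → ∑[ b < n ] b2n (b == c) ≡ 1
∑-indicator-== {n} c = trans (sum-cong-≗ (λ b → sym (*-identityʳ (b2n (b == c))))) (∑-select c (λ _ → 1))

∑-remove-point : ∀ {n} (P : Fin n → Bool) c → P c ≡ true →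
  ∑[ b < n ] b2n (P b) ≡ 1 + ∑[ b < n ] b2n (P b ∧ not (b == c))
∑-remove-point {n} P c Pc = begin
  ∑[ b < n ] b2n (P b)
    ≡⟨ sum-cong-≗ split ⟩
  ∑[ b < n ] (b2n (b == c) + b2n (P b ∧ not (b == c)))
    ≡⟨ ∑-distrib-+ (λ b → b2n (b == c)) (λ b → b2n (P b ∧ not (b == c))) ⟩
  ∑[ b < n ] b2n (b == c) + ∑[ b < n ] b2n (P b ∧ not (b == c))
    ≡⟨ cong (_+ ∑[ b < n ] b2n (P b ∧ not (b == c))) (∑-indicator-== c) ⟩
  1 + ∑[ b < n ] b2n (P b ∧ not (b == c)) ∎
  where
  open ≡-Reasoning
  split : ∀ b → b2n (P b) ≡ b2n (b == c) + b2n (P b ∧ not (b == c))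
  split b with b Fin.≟ c
  ... | yes refl rewrite Pc = refl
  ... | no _     rewrite ∧-identityʳ (P b) = refl

deg-remove-neighbour : ∀ {n} (G : Graph n) a c → adj G a c ≡ true →
  deg G a ≡ 1 + ∑[ b < n ] b2n (adj G a b ∧ not (b == c))
deg-remove-neighbour G a c a~c = trans (deg-∑ G a) (∑-remove-point (adj G a) c a~c)

deg-remove-neighbours : ∀ {n} (G : Graph n) a c₁ c₂ → c₁ ≢ c₂ → adj G a c₁ ≡ true → adj G a c₂ ≡ true →
  deg G a ≡ 2 + ∑[ b < n ] b2n (adj G a b ∧ not (b == c₁) ∧ not (b == c₂))
deg-remove-neighbours {n} G a c₁ c₂ c₁≢c₂ a~c₁ a~c₂ = begin
  deg G a
    ≡⟨ deg-remove-neighbour G a c₁ a~c₁ ⟩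
  1 + ∑[ b < n ] b2n (adj G a b ∧ not (b == c₁))
    ≡⟨ cong suc (∑-remove-point (λ b → adj G a b ∧ not (b == c₁)) c₂ c₂-kept) ⟩
  2 + ∑[ b < n ] b2n ((adj G a b ∧ not (b == c₁)) ∧ not (b == c₂))
    ≡⟨ cong (2 +_) (sum-cong-≗ (λ b → cong b2n (∧-assoc (adj G a b) (not (b == c₁)) (not (b == c₂))))) ⟩
  2 + ∑[ b < n ] b2n (adj G a b ∧ not (b == c₁) ∧ not (b == c₂)) ∎
  where
  open ≡-Reasoning
  c₂-kept : (adj G a c₂ ∧ not (c₂ == c₁)) ≡ true
  c₂-kept rewrite a~c₂ | ==-≢ (λ e → c₁≢c₂ (sym e)) = refl

triangle : ∀ {n} → Fin n → Fin n → Fin n → Fin 3 → Fin n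
triangle a b c Fin.zero                    = a
triangle a b c (Fin.suc Fin.zero)          = b
triangle a b c (Fin.suc (Fin.suc Fin.zero)) = c

triangle-isCycle : ∀ {n} (G : Graph n) {a b c} → adj G a b ≡ true → adj G b c ≡ true → adj G a c ≡ true →
  IsCycle G 3 (triangle a b c)
triangle-isCycle G {a} {b} {c} a~b b~c a~c = record { len≥3 = ≤-refl ; distinct = distinct ; closed = closed }
  where
  distinct : ∀ {i j} → triangle a b c i ≡ triangle a b c j → i ≡ j
  distinct {Fin.zero}                     {Fin.zero}                     _ = refl
  distinct {Fin.suc Fin.zero}             {Fin.suc Fin.zero}             _ = refl
  distinct {Fin.suc (Fin.suc Fin.zero)}   {Fin.suc (Fin.suc Fin.zero)}   _ = refl
  distinct {Fin.zero}                     {Fin.suc Fin.zero}             e = ⊥-elim (adj⇒≢ G a~b e)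
  distinct {Fin.zero}                     {Fin.suc (Fin.suc Fin.zero)}   e = ⊥-elim (adj⇒≢ G a~c e)
  distinct {Fin.suc Fin.zero}             {Fin.zero}                     e = ⊥-elim (adj⇒≢ G a~b (sym e))
  distinct {Fin.suc Fin.zero}             {Fin.suc (Fin.suc Fin.zero)}   e = ⊥-elim (adj⇒≢ G b~c e)
  distinct {Fin.suc (Fin.suc Fin.zero)}   {Fin.zero}                     e = ⊥-elim (adj⇒≢ G a~c (sym e))
  distinct {Fin.suc (Fin.suc Fin.zero)}   {Fin.suc Fin.zero}             e = ⊥-elim (adj⇒≢ G b~c (sym e))
  closed : ∀ i → adj G (triangle a b c i) (triangle a b c (next i)) ≡ true
  closed Fin.zero                    = a~b
  closed (Fin.suc Fin.zero)          = b~c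
  closed (Fin.suc (Fin.suc Fin.zero)) = adj-sym G a~c

-- A triangle uvw would be a second cycle; sharing the edge uv with C, it would put v on C.
no-triangle-off-cycle : ∀ {n} {G : Graph n} {L c} → UnicyclicWith G L c → ∀ {u v w} → (∀ j → c j ≢ v) →
  adj G u v ≡ true → adj G v w ≡ true → adj G u w ≡ true → ⊥
no-triangle-off-cycle {G = G} (_ , _ , unique) {u} {v} {w} v∉c u~v v~w u~w
  with proj₂ (unique 3 (triangle u v w) (triangle-isCycle G u~v v~w u~w) u v) (Fin.zero , inj₁ (refl , refl))
... | j , inj₁ (_ , cj′≡v) = v∉c (next j) cj′≡v
... | j , inj₂ (cj≡v , _)  = v∉c j cj≡v

reach-neighbour : ∀ {n} (G : Graph n) {u v w} → adj G u v ≡ true → adj G v w ≡ true → w ≢ u →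
  Reach (delEdge G u v) v w
reach-neighbour G {u} {v} {w} u~v v~w w≢u = step kept here
  where
  kept : delEdge G u v v w ≡ true
  kept rewrite v~w | ==-≢ (λ e → adj⇒≢ G u~v (sym e)) | ==-refl v | ==-≢ w≢u = refl

toℕ-next : ∀ {L} (i : Fin (suc L)) →
  (toℕ i < L × toℕ (next i) ≡ suc (toℕ i)) ⊎ (toℕ i ≡ L × next i ≡ Fin.zero)
toℕ-next {L} i with toℕ i <? L
... | yes i<L = inj₁ (i<L , toℕ-fromℕ< (s≤s i<L))
... | no  i≮L = inj₂ (≤-antisym (≤-pred (toℕ<n i)) (≮⇒≥ i≮L) , refl)

next²≢id : ∀ {L} → 3 ≤ L → (i : Fin L) → next (next i) ≢ i
next²≢id {suc L} 3≤L i nni≡i with toℕ-next i | toℕ-next (next i)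
... | inj₁ (_ , t₁) | inj₁ (_ , t₂) = 2+m≢m (trans (sym (trans t₂ (cong suc t₁))) (cong toℕ nni≡i))
  where
  2+m≢m : ∀ {m} → suc (suc m) ≢ m
  2+m≢m ()
... | inj₁ (_ , t₁) | inj₂ (t₂ , n₂) = <⇒≱ (≤-pred 3≤L) (≤-reflexive (trans (sym t₂) (trans t₁ (cong suc i≡0))))
  where
  i≡0 : toℕ i ≡ 0
  i≡0 = trans (cong toℕ (sym nni≡i)) (cong toℕ n₂)
... | inj₂ (t₁ , n₁) | r rewrite n₁ with r
...   | inj₁ (_ , t₂) = <⇒≱ (≤-pred 3≤L) (≤-reflexive (trans (sym t₁) (trans (cong toℕ (sym nni≡i)) t₂)))
...   | inj₂ (0≡L , _) = <⇒≱ (≤-pred 3≤L) (≤-trans (≤-reflexive (sym 0≡L)) z≤n)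

-- Replace the edges pb with S b by qb; specA and specB are instances by definition.
moveEdges : ∀ {n} → Graph n → (p q : Fin n) → (Fin n → Bool) → Fin n → Fin n → Bool
moveEdges G p q S a b =
  (adj G a b ∧ not ((a == p ∧ S b) ∨ (b == p ∧ S a))) ∨ (a == q ∧ S b) ∨ (b == q ∧ S a)

record Movable {n} (G : Graph n) (p q : Fin n) (S : Fin n → Bool) : Set where
  field
    p≢q     : p ≢ q
    p~q     : adj G p q ≡ true
    S⊆N[p]  : ∀ {b} → S b ≡ true → adj G p b ≡ true
    S∩N[q]  : ∀ {b} → S b ≡ true → adj G q b ≡ false
    q∉S     : S q ≡ false

module Moved {n} {G : Graph n} {p q : Fin n} {S : Fin n → Bool} (movable : Movable G p q S)
             (G* : Graph n) (G*-adj : ∀ a b → adj G* a b ≡ moveEdges G p q S a b) where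

  open Movable movable public

  p∉S : S p ≡ false
  p∉S with S p in Sp
  ... | false = refl
  ... | true with trans (sym (S⊆N[p] Sp)) (irrefl G p)
  ...   | ()

  q~p : adj G q p ≡ true
  q~p = adj-sym G p~q

  |S| : ℕ
  |S| = ∑[ b < n ] b2n (S b)

  adj*-off : ∀ {a b} → a ≢ p → a ≢ q → b ≢ p → b ≢ q → adj G* a b ≡ adj G a b
  adj*-off {a} {b} a≢p a≢q b≢p b≢q rewrite G*-adj a b | ==-≢ a≢p | ==-≢ a≢q | ==-≢ b≢p | ==-≢ b≢q
    with adj G a b
  ... | true  = refl
  ... | false = refl

  adj*-p-moved : ∀ {b} → S b ≡ true → adj G* p b ≡ false
  adj*-p-moved {b} Sb rewrite G*-adj p b | ==-refl p | ==-≢ p≢q | Sb | p∉S | ∧-zeroʳ (b == q) | ∧-zeroʳ (adj G p b) = refl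

  adj*-q-moved : ∀ {b} → S b ≡ true → adj G* q b ≡ true
  adj*-q-moved {b} Sb rewrite G*-adj q b | ==-refl q | Sb | S∩N[q] Sb = refl

  adj*-p-kept : ∀ {b} → S b ≡ false → adj G* p b ≡ adj G p b
  adj*-p-kept {b} Sb rewrite G*-adj p b | ==-refl p | ==-≢ p≢q | Sb | p∉S | ∧-zeroʳ (b == p) | ∧-zeroʳ (b == q)
    with adj G p b
  ... | true  = refl
  ... | false = refl

  adj*-q-kept : ∀ {b} → S b ≡ false → adj G* q b ≡ adj G q b
  adj*-q-kept {b} Sb rewrite G*-adj q b | ==-refl q | ==-≢ (λ e → p≢q (sym e)) | Sb | q∉S | ∧-zeroʳ (b == p) | ∧-zeroʳ (b == q)
    with adj G q b
  ... | true  = refl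
  ... | false = refl

  private
    b2n-cong-kept : ∀ {x y} → x ≡ y → b2n x ≡ b2n y + 0
    b2n-cong-kept {y = y} refl = sym (+-identityʳ (b2n y))

  deg*-q : deg G* q ≡ deg G q + |S|
  deg*-q = begin
    deg G* q                                             ≡⟨ deg-∑ G* q ⟩
    ∑[ b < n ] b2n (adj G* q b)                          ≡⟨ sum-cong-≗ gains ⟩
    ∑[ b < n ] (b2n (adj G q b) + b2n (S b))             ≡⟨ ∑-distrib-+ (λ b → b2n (adj G q b)) (λ b → b2n (S b)) ⟩
    ∑[ b < n ] b2n (adj G q b) + |S|                     ≡⟨ cong (_+ |S|) (deg-∑ G q) ⟨
    deg G q + |S|                                        ∎
    where
    open ≡-Reasoning
    gains : ∀ b → b2n (adj G* q b) ≡ b2n (adj G q b) + b2n (S b)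
    gains b with S b in Sb
    ... | true  rewrite adj*-q-moved Sb | S∩N[q] Sb = refl
    ... | false = b2n-cong-kept (adj*-q-kept Sb)

  deg*-p : deg G* p + |S| ≡ deg G p
  deg*-p = begin
    deg G* p + |S|                                       ≡⟨ cong (_+ |S|) (deg-∑ G* p) ⟩
    ∑[ b < n ] b2n (adj G* p b) + |S|                    ≡⟨ ∑-distrib-+ (λ b → b2n (adj G* p b)) (λ b → b2n (S b)) ⟨
    ∑[ b < n ] (b2n (adj G* p b) + b2n (S b))            ≡⟨ sum-cong-≗ losses ⟩
    ∑[ b < n ] b2n (adj G p b)                           ≡⟨ deg-∑ G p ⟨
    deg G p                                              ∎
    where
    open ≡-Reasoning
    losses : ∀ b → b2n (adj G* p b) + b2n (S b) ≡ b2n (adj G p b)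
    losses b with S b in Sb
    ... | true  rewrite adj*-p-moved Sb | S⊆N[p] Sb = refl
    ... | false = sym (b2n-cong-kept (sym (adj*-p-kept Sb)))

  deg*-off : ∀ {w} → w ≢ p → w ≢ q → deg G* w ≡ deg G w
  deg*-off {w} w≢p w≢q with S w in Sw
  ... | false = trans (deg-∑ G* w) (trans (sum-cong-≗ (λ b → cong b2n (unchanged b))) (sym (deg-∑ G w)))
    where
    unchanged : ∀ b → adj G* w b ≡ adj G w b
    unchanged b rewrite G*-adj w b | ==-≢ w≢p | ==-≢ w≢q | Sw | ∧-zeroʳ (b == p) | ∧-zeroʳ (b == q)
      with adj G w b
    ... | true  = refl
    ... | false = refl
  ... | true = +-cancelʳ-≡ 1 _ _ (begin
    deg G* w + 1                                                   ≡⟨ cong₂ _+_ (deg-∑ G* w) (sym (∑-indicator-== p)) ⟩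
    ∑[ b < n ] b2n (adj G* w b) + ∑[ b < n ] b2n (b == p)          ≡⟨ ∑-distrib-+ (λ b → b2n (adj G* w b)) (λ b → b2n (b == p)) ⟨
    ∑[ b < n ] (b2n (adj G* w b) + b2n (b == p))                   ≡⟨ sum-cong-≗ swap ⟩
    ∑[ b < n ] (b2n (adj G w b) + b2n (b == q))                    ≡⟨ ∑-distrib-+ (λ b → b2n (adj G w b)) (λ b → b2n (b == q)) ⟩
    ∑[ b < n ] b2n (adj G w b) + ∑[ b < n ] b2n (b == q)           ≡⟨ cong₂ _+_ (sym (deg-∑ G w)) (∑-indicator-== q) ⟩
    deg G w + 1                                                    ∎)
    where
    open ≡-Reasoning
    swap : ∀ b → b2n (adj G* w b) + b2n (b == p) ≡ b2n (adj G w b) + b2n (b == q)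
    swap b rewrite G*-adj w b | ==-≢ w≢p | ==-≢ w≢q | Sw with b Fin.≟ p
    ... | yes refl rewrite ==-≢ p≢q | adj-sym G (S⊆N[p] Sw) = refl
    ... | no b≢p with b Fin.≟ q
    ...   | yes refl rewrite trans (Graph.sym G w q) (S∩N[q] Sw) = refl
    ...   | no b≢q with adj G w b
    ...     | true  = refl
    ...     | false = refl

  -- FL / K bounds the terms of SO(G) from above, FR / K those of SO(G*) from below.
  module Scaled (K′ : ℕ) where

    K : ℕ
    K = suc K′

    FL FR : Fin n → Fin n → ℕ
    FL a b = b2n (adj G a b) * suc ⌊ K √ radicand (deg G) a b ⌋
    FR a b = b2n (adj G* a b) * ⌊ K √ radicand (deg G*) a b ⌋

    FL-adj : ∀ {a b} → adj G a b ≡ true → FL a b ≡ suc ⌊ K √ radicand (deg G) a b ⌋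
    FL-adj a~b rewrite a~b = +-identityʳ _

    FL-nonadj : ∀ {a b} → adj G a b ≡ false → FL a b ≡ 0
    FL-nonadj a≁b rewrite a≁b = refl

    FR-adj : ∀ {a b} → adj G* a b ≡ true → FR a b ≡ ⌊ K √ radicand (deg G*) a b ⌋
    FR-adj a~b rewrite a~b = +-identityʳ _

    FR-nonadj : ∀ {a b} → adj G* a b ≡ false → FR a b ≡ 0
    FR-nonadj a≁b rewrite a≁b = refl

    FL-sym : Symmetric FL
    FL-sym a b rewrite Graph.sym G a b | +-comm (deg G a * deg G a) (deg G b * deg G b) = refl

    FR-sym : Symmetric FR
    FR-sym a b rewrite Graph.sym G* a b | +-comm (deg G* a * deg G* a) (deg G* b * deg G* b) = refl

    FL-diag : ZeroDiagonal FL
    FL-diag a rewrite irrefl G a = refl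

    FR-diag : ZeroDiagonal FR
    FR-diag a rewrite irrefl G* a = refl

    FL≤FR+1 : ∀ a b → a ≢ p → a ≢ q → b ≢ p → b ≢ q → FL a b ≤ FR a b + 1
    FL≤FR+1 a b a≢p a≢q b≢p b≢q rewrite adj*-off a≢p a≢q b≢p b≢q | deg*-off a≢p a≢q | deg*-off b≢p b≢q
      with adj G a b
    ... | true  = ≤-reflexive (trans (+-identityʳ _) (trans (+-comm 1 _) (cong (_+ 1) (sym (+-identityʳ _)))))
    ... | false = z≤n

    -- The summand M pays for the rounding in the upper bound ⌊K√x⌋ + 1 of the old term.
    Row : ℕ → Fin n → ℕ → ℕ → Set
    Row M b g h = M * (FL p b + FL q b) + g ≤ M * (FR p b + FR q b) + (M + h)

    pay-rounding : ∀ M {x y g h} → M * x + g ≤ M * y + h → M * suc x + g ≤ M * y + (M + h)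
    pay-rounding M {x} {y} {g} {h} le = begin
      M * suc x + g     ≡⟨ cong (_+ g) (*-suc M x) ⟩
      M + M * x + g     ≡⟨ +-assoc M (M * x) g ⟩
      M + (M * x + g)   ≤⟨ +-monoʳ-≤ M le ⟩
      M + (M * y + h)   ≡⟨ +-assoc M (M * y) h ⟨
      M + M * y + h     ≡⟨ cong (_+ h) (+-comm M (M * y)) ⟩
      M * y + M + h     ≡⟨ +-assoc (M * y) M h ⟩
      M * y + (M + h)   ∎
      where open ≤-Reasoning

    row : ∀ M {b x y g h} → FL p b + FL q b ≡ suc x → FR p b + FR q b ≡ y →
          M * x + g ≤ M * y + h → Row M b g h
    row M {b} {g = g} {h} L≡ R≡ le =
      subst₂ (λ l r → M * l + g ≤ M * r + (M + h)) (sym L≡) (sym R≡) (pay-rounding M le)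

    row-moved : ∀ M {b g h} → b ≢ p → b ≢ q → S b ≡ true →
      M * ⌊ K √ (deg G p * deg G p + deg G b * deg G b) ⌋ + g ≤ M * ⌊ K √ (deg G* q * deg G* q + deg G b * deg G b) ⌋ + h →
      Row M b g h
    row-moved M {b} b≢p b≢q Sb =
      row M (trans (cong₂ _+_ (FL-adj (S⊆N[p] Sb)) (FL-nonadj (S∩N[q] Sb))) (+-identityʳ _))
            (trans (cong₂ _+_ (FR-nonadj (adj*-p-moved Sb)) (FR-adj (adj*-q-moved Sb)))
                   (cong (λ d → ⌊ K √ (deg G* q * deg G* q + d * d) ⌋) (deg*-off b≢p b≢q)))

    row-kept-p : ∀ M {b g h} → b ≢ p → b ≢ q → S b ≡ false → adj G p b ≡ true → adj G q b ≡ false →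
      M * ⌊ K √ (deg G p * deg G p + deg G b * deg G b) ⌋ + g ≤ M * ⌊ K √ (deg G* p * deg G* p + deg G b * deg G b) ⌋ + h →
      Row M b g h
    row-kept-p M {b} b≢p b≢q Sb p~b q≁b =
      row M (trans (cong₂ _+_ (FL-adj p~b) (FL-nonadj q≁b)) (+-identityʳ _))
            (trans (cong₂ _+_ (FR-adj (trans (adj*-p-kept Sb) p~b)) (FR-nonadj (trans (adj*-q-kept Sb) q≁b)))
                   (trans (+-identityʳ _) (cong (λ d → ⌊ K √ (deg G* p * deg G* p + d * d) ⌋) (deg*-off b≢p b≢q))))

    row-kept-q : ∀ M {b g h} → b ≢ p → b ≢ q → S b ≡ false → adj G p b ≡ false → adj G q b ≡ true →
      M * ⌊ K √ (deg G q * deg G q + deg G b * deg G b) ⌋ + g ≤ M * ⌊ K √ (deg G* q * deg G* q + deg G b * deg G b) ⌋ + h →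
      Row M b g h
    row-kept-q M {b} b≢p b≢q Sb p≁b q~b =
      row M (cong₂ _+_ (FL-nonadj p≁b) (FL-adj q~b))
            (trans (cong₂ _+_ (FR-nonadj (trans (adj*-p-kept Sb) p≁b)) (FR-adj (trans (adj*-q-kept Sb) q~b)))
                   (cong (λ d → ⌊ K √ (deg G* q * deg G* q + d * d) ⌋) (deg*-off b≢p b≢q)))

    row-isolated : ∀ M {b} → S b ≡ false → adj G p b ≡ false → adj G q b ≡ false → Row M b 0 0
    row-isolated M {b} Sb p≁b q≁b
      rewrite FL-nonadj p≁b | FL-nonadj q≁b | FR-nonadj (trans (adj*-p-kept Sb) p≁b) | FR-nonadj (trans (adj*-q-kept Sb) q≁b)
      = ≤-trans (≤-reflexive (+-identityʳ (M * 0))) (m≤m+n (M * 0) (M + 0))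

    open TwoPoints p q p≢q using (∑off)

    SO<-by-rows : ∀ M′ → let M = suc M′ in (c e : Fin n → ℕ) →
      (∀ b → b ≢ p → b ≢ q → Row M b (c b) (e b)) →
      (g h : ℕ) → M * ⌊ K √ radicand (deg G) p q ⌋ + g ≤ M * ⌊ K √ radicand (deg G*) p q ⌋ + h →
      2 * (M + h) + 2 * (n * M + ∑off e) + M * (n * n) < 2 * g + 2 * ∑off c →
      SO< G G*
    SO<-by-rows M′ c e rows g h pq budget =
      FixedDenominator.SqrtSum<-⌊√⌋ K′ (radicands G) (radicands G*) (*-cancelˡ-< 2 _ _ doubled)
      where
      M : ℕ
      M = suc M′
      pq-row : M * FL p q + g ≤ M * FR p q + (M + h)
      pq-row = subst₂ (λ l r → M * l + g ≤ M * r + (M + h)) (sym (FL-adj p~q)) (sym (FR-adj (trans (adj*-p-kept q∉S) p~q)))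
        (pay-rounding M {x = ⌊ K √ radicand (deg G) p q ⌋} {y = ⌊ K √ radicand (deg G*) p q ⌋} pq)
      scaled : M * (∑[ a < n ] ∑[ b < n ] FL a b) < M * (∑[ a < n ] ∑[ b < n ] FR a b)
      scaled = TwoPoints.compare-by-rows p q p≢q M FL FR FL-sym FL-diag FR-sym FR-diag FL≤FR+1
                 c e rows g (M + h) pq-row budget
      doubled : 2 * sumℕ (map (λ x → suc ⌊ K √ x ⌋) (radicands G)) < 2 * sumℕ (map ⌊ K √_⌋ (radicands G*))
      doubled = subst₂ _<_ (sym (twice-sumℕ-radicands G (λ x → suc ⌊ K √ x ⌋))) (sym (twice-sumℕ-radicands G* ⌊ K √_⌋))
                       (*-cancelˡ-< M _ _ scaled)

weights : Bool → Bool → Bool → ℕ → ℕ → ℕ → ℕ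
weights x y w k₁ k₂ k₃ = b2n x * k₁ + b2n y * k₂ + b2n w * k₃

weights-100 : ∀ k₁ k₂ k₃ → weights true false false k₁ k₂ k₃ ≡ k₁
weights-100 k₁ k₂ k₃ = trans (+-identityʳ (k₁ + 0 + 0)) (trans (+-identityʳ (k₁ + 0)) (+-identityʳ k₁))

weights-010 : ∀ k₁ k₂ k₃ → weights false true false k₁ k₂ k₃ ≡ k₂
weights-010 k₁ k₂ k₃ = trans (+-identityʳ (k₂ + 0)) (+-identityʳ k₂)

weights-001 : ∀ k₁ k₂ k₃ → weights false false true k₁ k₂ k₃ ≡ k₃
weights-001 k₁ k₂ k₃ = +-identityʳ k₃

module Transfer {n} (G : Graph n) (p q z : Fin n) (S : Fin n → Bool)
    (S-def : ∀ b → S b ≡ (adj G p b ∧ not (b == q) ∧ not (b == z)))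
    (p~q : adj G p q ≡ true) (p~z : adj G p z ≡ true) (z≢q : z ≢ q)
    (no-triangle : ∀ {b} → adj G p b ≡ true → adj G q b ≡ true → ⊥)
    (G* : Graph n) (G*-adj : ∀ a b → adj G* a b ≡ moveEdges G p q S a b) where

  S-z : S z ≡ false
  S-z rewrite S-def z | ==-refl z = trans (cong (adj G p z ∧_) (∧-zeroʳ (not (z == q)))) (∧-zeroʳ (adj G p z))

  S-q : S q ≡ false
  S-q rewrite S-def q | ==-refl q = ∧-zeroʳ (adj G p q)

  S-other : ∀ {b} → b ≢ q → b ≢ z → S b ≡ adj G p b
  S-other {b} b≢q b≢z rewrite S-def b | ==-≢ b≢q | ==-≢ b≢z = ∧-identityʳ (adj G p b)

  S⊆N[p] : ∀ {b} → S b ≡ true → adj G p b ≡ true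
  S⊆N[p] {b} Sb = ∧-conicalˡ _ _ (trans (sym (S-def b)) Sb)

  S∩N[q] : ∀ {b} → S b ≡ true → adj G q b ≡ false
  S∩N[q] {b} Sb with adj G q b in q~b
  ... | true  = ⊥-elim (no-triangle (S⊆N[p] Sb) q~b)
  ... | false = refl

  movable : Movable G p q S
  movable = record { p≢q = adj⇒≢ G p~q ; p~q = p~q ; S⊆N[p] = S⊆N[p] ; S∩N[q] = S∩N[q] ; q∉S = S-q }

  open Moved movable G* G*-adj public hiding (p~q; S⊆N[p]; S∩N[q])

  R : Fin n → Bool
  R b = adj G q b ∧ not (b == p)

  |R| : ℕ
  |R| = ∑[ b < n ] b2n (R b)

  deg-p : deg G p ≡ 2 + |S|
  deg-p = trans (deg-remove-neighbours G p q z (λ e → z≢q (sym e)) p~q p~z)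
                (cong (2 +_) (sum-cong-≗ (λ b → cong b2n (sym (S-def b)))))

  deg*-p≡2 : deg G* p ≡ 2
  deg*-p≡2 = +-cancelʳ-≡ |S| (deg G* p) 2 (trans deg*-p deg-p)

  deg-q : deg G q ≡ 1 + |R|
  deg-q = deg-remove-neighbour G q p q~p

  R⊆off : ∀ {b} → R b ≡ true → TwoPoints.off p q p≢q b ≡ 1
  R⊆off {b} Rb = TwoPoints.off-≢ p q p≢q b≢p (λ e → adj⇒≢ G q~b (sym e))
    where
    q~b : adj G q b ≡ true
    q~b = ∧-conicalˡ _ _ Rb
    b≢p : b ≢ p
    b≢p refl with trans (sym Rb) (trans (cong (λ x → adj G q p ∧ not x) (==-refl p)) (∧-zeroʳ (adj G q p)))
    ... | ()

  q≁z : adj G q z ≡ false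
  q≁z with adj G q z in q~z
  ... | true  = ⊥-elim (no-triangle p~z q~z)
  ... | false = refl

  R-z : R z ≡ false
  R-z rewrite q≁z = refl

  S⊆off : ∀ {b} → S b ≡ true → TwoPoints.off p q p≢q b ≡ 1
  S⊆off {b} Sb = TwoPoints.off-≢ p q p≢q (λ e → adj⇒≢ G (S⊆N[p] Sb) (sym e)) (λ { refl → S≢q Sb })
    where
    S≢q : S q ≡ true → ⊥
    S≢q Sq with trans (sym Sq) S-q
    ... | ()

  -- Degrees are written through s = |S| and t = |R|: d(p) = 2 + s, d(q) = 1 + t, d*(q) = 1 + t + s, d*(p) = 2.
  record Certificate (K′ M′ s t : ℕ) : Set where
    field
      g-moved h-moved g-kept h-kept g-z h-z g-pq h-pq : ℕ
      moved : ∀ {b} → adj G p b ≡ true → b ≢ q → b ≢ z →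
        suc M′ * ⌊ suc K′ √ ((2 + s) * (2 + s) + deg G b * deg G b) ⌋ + g-moved
          ≤ suc M′ * ⌊ suc K′ √ ((suc t + s) * (suc t + s) + deg G b * deg G b) ⌋ + h-moved
      kept : ∀ {b} → adj G q b ≡ true → b ≢ p →
        suc M′ * ⌊ suc K′ √ (suc t * suc t + deg G b * deg G b) ⌋ + g-kept
          ≤ suc M′ * ⌊ suc K′ √ ((suc t + s) * (suc t + s) + deg G b * deg G b) ⌋ + h-kept
      z-edge :
        suc M′ * ⌊ suc K′ √ ((2 + s) * (2 + s) + deg G z * deg G z) ⌋ + g-z
          ≤ suc M′ * ⌊ suc K′ √ (2 * 2 + deg G z * deg G z) ⌋ + h-z
      pq-edge :
        suc M′ * ⌊ suc K′ √ ((2 + s) * (2 + s) + suc t * suc t) ⌋ + g-pq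
          ≤ suc M′ * ⌊ suc K′ √ (2 * 2 + (suc t + s) * (suc t + s)) ⌋ + h-pq
      budget :
        2 * (suc M′ + h-pq) + 2 * (n * suc M′ + (s * h-moved + t * h-kept + h-z)) + suc M′ * (n * n)
          < 2 * g-pq + 2 * (s * g-moved + t * g-kept + g-z)

  module Certified {K′ M′ : ℕ} (cert : Certificate K′ M′ |S| |R|) where

    open Certificate cert
    open Scaled K′
    open TwoPoints p q p≢q using (∑off; ∑off-+; ∑off-indicator; ∑off-point)

    M : ℕ
    M = suc M′

    deg*-q′ : deg G* q ≡ suc |R| + |S|
    deg*-q′ = trans deg*-q (cong (_+ |S|) deg-q)

    convert : ∀ w {x x′ y y′ g h} → x′ ≡ x → y′ ≡ y →
      M * ⌊ K √ (x * x + w) ⌋ + g ≤ M * ⌊ K √ (y * y + w) ⌋ + h →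
      M * ⌊ K √ (x′ * x′ + w) ⌋ + g ≤ M * ⌊ K √ (y′ * y′ + w) ⌋ + h
    convert w refl refl le = le

    c e : Fin n → ℕ
    c b = weights (S b) (R b) (b == z) g-moved g-kept g-z
    e b = weights (S b) (R b) (b == z) h-moved h-kept h-z

    row-by-kind : ∀ {b x y w} → S b ≡ x → R b ≡ y → (b == z) ≡ w →
      Row M b (weights x y w g-moved g-kept g-z) (weights x y w h-moved h-kept h-z) → Row M b (c b) (e b)
    row-by-kind Sb Rb bz r rewrite Sb | Rb | bz = r

    row-z : z ≢ p → z ≢ q → Row M z (c z) (e z)
    row-z z≢p z≢q = row-by-kind S-z R-z (==-refl z)
      (subst₂ (Row M z) (sym (weights-001 g-moved g-kept g-z)) (sym (weights-001 h-moved h-kept h-z))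
        (row-kept-p M z≢p z≢q S-z p~z q≁z (convert (deg G z * deg G z) deg-p deg*-p≡2 z-edge)))

    row-other : ∀ {b} → b ≢ p → b ≢ q → b ≢ z → ∀ x → adj G p b ≡ x → ∀ y → adj G q b ≡ y → Row M b (c b) (e b)
    row-other b≢p b≢q b≢z true  p~b true  q~b = ⊥-elim (no-triangle p~b q~b)
    row-other {b} b≢p b≢q b≢z true  p~b false q≁b = row-by-kind Sb (cong (_∧ not (b == p)) q≁b) (==-≢ b≢z)
      (subst₂ (Row M b) (sym (weights-100 g-moved g-kept g-z)) (sym (weights-100 h-moved h-kept h-z))
        (row-moved M b≢p b≢q Sb (convert (deg G b * deg G b) deg-p deg*-q′ (moved p~b b≢q b≢z))))
      where
      Sb : S b ≡ true
      Sb = trans (S-other b≢q b≢z) p~b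
    row-other {b} b≢p b≢q b≢z false p≁b true  q~b = row-by-kind Sb Rb (==-≢ b≢z)
      (subst₂ (Row M b) (sym (weights-010 g-moved g-kept g-z)) (sym (weights-010 h-moved h-kept h-z))
        (row-kept-q M b≢p b≢q Sb p≁b q~b (convert (deg G b * deg G b) deg-q deg*-q′ (kept q~b b≢p))))
      where
      Sb : S b ≡ false
      Sb = trans (S-other b≢q b≢z) p≁b
      Rb : R b ≡ true
      Rb rewrite q~b | ==-≢ b≢p = refl
    row-other {b} b≢p b≢q b≢z false p≁b false q≁b =
      row-by-kind Sb (cong (_∧ not (b == p)) q≁b) (==-≢ b≢z) (row-isolated M Sb p≁b q≁b)
      where
      Sb : S b ≡ false
      Sb = trans (S-other b≢q b≢z) p≁b

    rows : ∀ b → b ≢ p → b ≢ q → Row M b (c b) (e b)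
    rows b b≢p b≢q = by-cases (b Fin.≟ z)
      where
      by-cases : Dec (b ≡ z) → Row M b (c b) (e b)
      by-cases (yes refl) = row-z b≢p b≢q
      by-cases (no b≢z)   = row-other b≢p b≢q b≢z (adj G p b) refl (adj G q b) refl

    ∑off-weights : ∀ k₁ k₂ k₃ → ∑off (λ b → weights (S b) (R b) (b == z) k₁ k₂ k₃) ≡ |S| * k₁ + |R| * k₂ + k₃
    ∑off-weights k₁ k₂ k₃ = begin
      ∑off (λ b → b2n (S b) * k₁ + b2n (R b) * k₂ + b2n (b == z) * k₃)
        ≡⟨ ∑off-+ (λ b → b2n (S b) * k₁ + b2n (R b) * k₂) (λ b → b2n (b == z) * k₃) ⟩
      ∑off (λ b → b2n (S b) * k₁ + b2n (R b) * k₂) + ∑off (λ b → b2n (b == z) * k₃)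
        ≡⟨ cong₂ _+_ (∑off-+ (λ b → b2n (S b) * k₁) (λ b → b2n (R b) * k₂)) (∑off-point z k₃ z≢p z≢q) ⟩
      ∑off (λ b → b2n (S b) * k₁) + ∑off (λ b → b2n (R b) * k₂) + k₃
        ≡⟨ cong₂ (λ x y → x + y + k₃) (∑off-indicator S k₁ S⊆off) (∑off-indicator R k₂ R⊆off) ⟩
      |S| * k₁ + |R| * k₂ + k₃ ∎
      where
      open ≡-Reasoning
      z≢p : z ≢ p
      z≢p e = adj⇒≢ G p~z (sym e)

    pq : M * ⌊ K √ (deg G p * deg G p + deg G q * deg G q) ⌋ + g-pq
         ≤ M * ⌊ K √ (deg G* p * deg G* p + deg G* q * deg G* q) ⌋ + h-pq
    pq rewrite deg-p | deg-q | deg*-p≡2 | deg*-q′ = pq-edge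

    SO<-certified : SO< G G*
    SO<-certified = SO<-by-rows M′ c e rows g-pq h-pq pq
      (subst₂ (λ x y → 2 * (M + h-pq) + 2 * (n * M + x) + M * (n * n) < 2 * g-pq + 2 * y)
              (sym (∑off-weights h-moved h-kept h-z)) (sym (∑off-weights g-moved g-kept g-z)) budget)

  SO<-transfer : ∀ {K′ M′ s t} → |S| ≡ s → |R| ≡ t → Certificate K′ M′ s t → SO< G G*
  SO<-transfer refl refl = Certified.SO<-certified

≤-from-sum : ∀ a b {c} → a + b ≡ c → a ≤ c
≤-from-sum a b a+b≡c = subst (a ≤_) a+b≡c (m≤m+n a b)

square≤4 : ∀ {d} → d ≤ 2 → d * d ≤ 2 * 2
square≤4 d≤2 = *-mono-≤ d≤2 d≤2

root-gain : ∀ K m D d → d ≤ 2 →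
  m * ⌊ K √ (m * m + d * d) ⌋ + m * (K * D) ≤ m * ⌊ K √ (D * D + d * d) ⌋ + K * (m * m + 2)
root-gain K m D d d≤2 = begin
  m * ⌊ K √ (m * m + d * d) ⌋ + m * (K * D)  ≤⟨ +-mono-≤ near-square (*-monoʳ-≤ m (⌊√⌋-square K D (d * d))) ⟩
  K * (m * m + 2) + m * ⌊ K √ (D * D + d * d) ⌋ ≡⟨ +-comm (K * (m * m + 2)) _ ⟩
  m * ⌊ K √ (D * D + d * d) ⌋ + K * (m * m + 2) ∎
  where
  open ≤-Reasoning
  identity : ∀ x → (x + 2 * 2) * x + 4 ≡ (x + 2) * (x + 2)
  identity = solve-∀
  near-square : m * ⌊ K √ (m * m + d * d) ⌋ ≤ K * (m * m + 2)
  near-square = ≤-trans (*-monoʳ-≤ m (⌊√⌋-mono K (+-monoʳ-≤ (m * m) (square≤4 d≤2))))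
                        (⌊√⌋-≤-ratio K (m * m + 2 * 2) (m * m + 2) m (≤-from-sum _ 4 (identity (m * m))))

root-shift : ∀ K M s d → M * ⌊ K √ ((2 + s) * (2 + s) + d) ⌋ + 0 ≤ M * ⌊ K √ (4 + d) ⌋ + M * (K * s)
root-shift K M s d = begin
  M * ⌊ K √ ((2 + s) * (2 + s) + d) ⌋ + 0   ≡⟨ +-identityʳ _ ⟩
  M * ⌊ K √ ((2 + s) * (2 + s) + d) ⌋       ≤⟨ *-monoʳ-≤ M (⌊√⌋-shift K s d) ⟩
  M * (⌊ K √ (4 + d) ⌋ + K * s)             ≡⟨ *-distribˡ-+ M _ (K * s) ⟩
  M * ⌊ K √ (4 + d) ⌋ + M * (K * s)         ∎
  where open ≤-Reasoning

decimal-step : ∀ K M x y A B B′ D → M * x ≤ K * A → K * B < M * suc y → A + B′ ≤ D + B →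
  M * x + K * B′ ≤ M * y + (K * D + M)
decimal-step K M x y A B B′ D x≤A B<y sums = begin
  M * x + K * B′          ≤⟨ +-monoˡ-≤ (K * B′) x≤A ⟩
  K * A + K * B′          ≡⟨ *-distribˡ-+ K A B′ ⟨
  K * (A + B′)            ≤⟨ *-monoʳ-≤ K sums ⟩
  K * (D + B)             ≡⟨ *-distribˡ-+ K D B ⟩
  K * D + K * B           ≤⟨ +-monoʳ-≤ (K * D) (<⇒≤ B<y) ⟩
  K * D + M * suc y       ≡⟨ shuffle (K * D) M y ⟩
  M * y + (K * D + M)     ∎
  where
  open ≤-Reasoning
  shuffle : ∀ k M y → k + M * suc y ≡ M * y + (k + M)
  shuffle = solve-∀

radicand-pq : ∀ s m → 2 ≤ m → (2 + s) * (2 + s) + m * m ≤ 2 * 2 + (m + s) * (m + s)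
radicand-pq s m 2≤m with m≤n⇒∃[o]m+o≡n 2≤m
... | w , refl = ≤-from-sum _ (2 * s * w) (identity s w)
  where
  identity : ∀ s w → (2 + s) * (2 + s) + (2 + w) * (2 + w) + 2 * s * w ≡ 2 * 2 + ((2 + w) + s) * ((2 + w) + s)
  identity = solve-∀

-- the rounding errors, of order M n², are absorbed once K is large
absorb : ∀ K W Z c x → x < K * c → W + c ≤ Z → K * W + x < K * Z
absorb K W Z c x x<Kc W+c≤Z = begin-strict
  K * W + x          <⟨ +-monoʳ-< (K * W) x<Kc ⟩
  K * W + K * c      ≡⟨ *-distribˡ-+ K W c ⟨
  K * (W + c)        ≤⟨ *-monoʳ-≤ K W+c≤Z ⟩
  K * Z              ∎
  where open ≤-Reasoning

cube : ℕ → ℕ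
cube x = x * x * x

error-bound : ∀ N K′ c x → cube (N + 2) * 100 ≤ K′ → x ≤ cube (N + 2) * (100 * suc c) → x < suc K′ * suc c
error-bound N K′ c x big x≤ = begin-strict
  x                              ≤⟨ x≤ ⟩
  cube (N + 2) * (100 * suc c)   ≡⟨ *-assoc (cube (N + 2)) 100 (suc c) ⟨
  cube (N + 2) * 100 * suc c     ≤⟨ *-monoˡ-≤ (suc c) big ⟩
  K′ * suc c                     <⟨ m<n+m (K′ * suc c) (s≤s z≤n) ⟩
  suc c + K′ * suc c             ∎
  where open ≤-Reasoning

⌊√⌋-scaled-mono : ∀ K M {x y} → x ≤ y → M * ⌊ K √ x ⌋ + 0 ≤ M * ⌊ K √ y ⌋ + 0
⌊√⌋-scaled-mono K M x≤y = +-monoˡ-≤ 0 (*-monoʳ-≤ M (⌊√⌋-mono K x≤y))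

square-+-mono : ∀ {a b} w → a ≤ b → a * a + w ≤ b * b + w
square-+-mono w a≤b = +-monoˡ-≤ w (*-mono-≤ a≤b a≤b)

-- Four-decimal bounds on square roots; M₀ is opaque so that 10000 * x is never unfolded.
opaque
  M₀′ : ℕ
  M₀′ = 9999

M₀ : ℕ
M₀ = suc M₀′

opaque
  unfolding M₀′

  √10≤3·1623 : ∀ K → M₀ * ⌊ K √ 10 ⌋ ≤ K * 31623
  √10≤3·1623 K = ⌊√⌋-≤-ratio K 10 31623 M₀ (≤-from-sum 1000000000 14129 refl)

  √13≤3·6056 : ∀ K → M₀ * ⌊ K √ 13 ⌋ ≤ K * 36056
  √13≤3·6056 K = ⌊√⌋-≤-ratio K 13 36056 M₀ (≤-from-sum 1300000000 35136 refl)

  √18≤4·2427 : ∀ K → M₀ * ⌊ K √ 18 ⌋ ≤ K * 42427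
  √18≤4·2427 K = ⌊√⌋-≤-ratio K 18 42427 M₀ (≤-from-sum 1800000000 50329 refl)

  2·2360<√5 : ∀ K → K * 22360 < M₀ * suc ⌊ K √ 5 ⌋
  2·2360<√5 K = ratio-<-⌊√⌋ K 5 22360 M₀′ (≤-from-sum 499969600 30400 refl)

  2·8284<√8 : ∀ K → K * 28284 < M₀ * suc ⌊ K √ 8 ⌋
  2·8284<√8 K = ratio-<-⌊√⌋ K 8 28284 M₀′ (≤-from-sum 799984656 15344 refl)

  4·1231<√17 : ∀ K → K * 41231 < M₀ * suc ⌊ K √ 17 ⌋
  4·1231<√17 K = ratio-<-⌊√⌋ K 17 41231 M₀′ (≤-from-sum 1699995361 4639 refl)

  4·4721<√20 : ∀ K → K * 44721 < M₀ * suc ⌊ K √ 20 ⌋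
  4·4721<√20 K = ratio-<-⌊√⌋ K 20 44721 M₀′ (≤-from-sum 1999967841 32159 refl)

  M₀≤49600 : M₀ ≤ 100 * 496
  M₀≤49600 = ≤-from-sum 10000 39600 refl

  M₀≤339200 : M₀ ≤ 100 * 3392
  M₀≤339200 = ≤-from-sum 10000 329200 refl

  budget-digits-du≥4 : 4 * 36056 + 496 ≤ M₀ * 10 + 2 * 22360
  budget-digits-du≥4 = ≤-refl

√[9+d²]≤3·6056 : ∀ K {d} → d ≤ 2 → M₀ * ⌊ K √ (3 * 3 + d * d) ⌋ ≤ K * 36056
√[9+d²]≤3·6056 K d≤2 = ≤-trans (*-monoʳ-≤ M₀ (⌊√⌋-mono K (+-monoʳ-≤ 9 (square≤4 d≤2)))) (√13≤3·6056 K)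

moved-gain-dv3 : ∀ K D d → 5 ≤ D → d ≤ 2 →
  M₀ * ⌊ K √ (3 * 3 + d * d) ⌋ + M₀ * (K * 5) ≤ M₀ * ⌊ K √ (D * D + d * d) ⌋ + K * 36056
moved-gain-dv3 K D d 5≤D d≤2 = begin
  M₀ * ⌊ K √ (3 * 3 + d * d) ⌋ + M₀ * (K * 5) ≤⟨ +-mono-≤ (√[9+d²]≤3·6056 K d≤2)
                                                     (*-monoʳ-≤ M₀ (≤-trans (*-monoʳ-≤ K 5≤D) (⌊√⌋-square K D (d * d)))) ⟩
  K * 36056 + M₀ * ⌊ K √ (D * D + d * d) ⌋    ≡⟨ +-comm (K * 36056) _ ⟩
  M₀ * ⌊ K √ (D * D + d * d) ⌋ + K * 36056    ∎
  where open ≤-Reasoning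

z-loss-dv3 : ∀ K d → 1 ≤ d → d ≤ 2 →
  M₀ * ⌊ K √ (3 * 3 + d * d) ⌋ + K * 22360 ≤ M₀ * ⌊ K √ (2 * 2 + d * d) ⌋ + (K * 36056 + M₀)
z-loss-dv3 K d 1≤d d≤2 = decimal-step K M₀ _ _ 36056 22360 22360 36056 (√[9+d²]≤3·6056 K d≤2)
  (<-≤-trans (2·2360<√5 K) (*-monoʳ-≤ M₀ (s≤s (⌊√⌋-mono K (+-monoʳ-≤ 4 (*-mono-≤ 1≤d 1≤d)))))) ≤-refl

moved-gain-dv3-D4 : ∀ K d → 1 ≤ d → d ≤ 2 →
  M₀ * ⌊ K √ (3 * 3 + d * d) ⌋ + K * 44721 ≤ M₀ * ⌊ K √ (4 * 4 + d * d) ⌋ + (K * 36056 + M₀)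
moved-gain-dv3-D4 K 1 _ _ = decimal-step K M₀ _ _ 31623 41231 44721 36056 (√10≤3·1623 K) (4·1231<√17 K) (≤-from-sum 76344 943 refl)
moved-gain-dv3-D4 K 2 _ _ = decimal-step K M₀ _ _ 36056 44721 44721 36056 (√13≤3·6056 K) (4·4721<√20 K) ≤-refl
moved-gain-dv3-D4 K (suc (suc (suc _))) _ (s≤s (s≤s ()))

z-loss-dv3-du3 : ∀ K d → 1 ≤ d → d ≤ 2 →
  M₀ * ⌊ K √ (3 * 3 + d * d) ⌋ + K * 22360 ≤ M₀ * ⌊ K √ (2 * 2 + d * d) ⌋ + (K * 31623 + M₀)
z-loss-dv3-du3 K 1 _ _ = decimal-step K M₀ _ _ 31623 22360 22360 31623 (√10≤3·1623 K) (2·2360<√5 K) ≤-refl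
z-loss-dv3-du3 K 2 _ _ = decimal-step K M₀ _ _ 36056 28284 22360 31623 (√13≤3·6056 K) (2·8284<√8 K) (≤-from-sum 58416 1491 refl)
z-loss-dv3-du3 K (suc (suc (suc _))) _ (s≤s (s≤s ()))

pq-gain-dv3-du3 : ∀ K → M₀ * ⌊ K √ (3 * 3 + 3 * 3) ⌋ + K * 44721 ≤ M₀ * ⌊ K √ (2 * 2 + 4 * 4) ⌋ + (K * 42427 + M₀)
pq-gain-dv3-du3 K = decimal-step K M₀ _ _ 42427 44721 44721 42427 (√18≤4·2427 K) (4·4721<√20 K) ≤-refl

quadratic≤cube : ∀ N → N * N + 2 * N + 4 ≤ cube (N + 2)
quadratic≤cube N = ≤-from-sum _ (N * N * N + 5 * (N * N) + 10 * N + 4) (identity N)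
  where
  identity : ∀ N → N * N + 2 * N + 4 + (N * N * N + 5 * (N * N) + 10 * N + 4) ≡ (N + 2) * (N + 2) * (N + 2)
  identity = solve-∀

quadratic≤cube′ : ∀ N → N * N + 2 * N + 8 ≤ cube (N + 2)
quadratic≤cube′ N = ≤-from-sum _ (N * N * N + 5 * (N * N) + 10 * N) (identity N)
  where
  identity : ∀ N → N * N + 2 * N + 8 + (N * N * N + 5 * (N * N) + 10 * N) ≡ (N + 2) * (N + 2) * (N + 2)
  identity = solve-∀

cubic≤cube : ∀ {m} N → m ≤ N → m * (N * N + 2 * N + 2) ≤ cube (N + 2) * (100 * 4)
cubic≤cube N m≤N = ≤-trans (*-monoˡ-≤ (N * N + 2 * N + 2) m≤N)
  (≤-trans (≤-from-sum _ (4 * (N * N) + 10 * N + 8) (identity N)) (m≤m*n (cube (N + 2)) 400))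
  where
  identity : ∀ N → N * (N * N + 2 * N + 2) + (4 * (N * N) + 10 * N + 8) ≡ (N + 2) * (N + 2) * (N + 2)
  identity = solve-∀

budget-a-dv≥4 : ∀ N K′ t s D → 2 ≤ s → 2 * s + 2 ≤ D → 2 + s ≤ N → cube (N + 2) * 100 ≤ K′ →
  2 * (2 + s + 0) + 2 * (N * (2 + s) + (s * (suc K′ * ((2 + s) * (2 + s) + 2)) + t * 0 + suc K′ * ((2 + s) * (2 + s) + 2)))
    + (2 + s) * (N * N)
  < 2 * 0 + 2 * (s * ((2 + s) * (suc K′ * D)) + t * 0 + (2 + s) * (suc K′ * 2))
budget-a-dv≥4 N K′ t s D 2≤s 2s+2≤D dv≤N big = subst₂ _<_ (sym (lhs N K′ t s)) (sym (rhs K′ t s D))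
  (absorb (suc K′) W Z 4 ((2 + s) * (N * N + 2 * N + 2)) (error-bound N K′ 3 _ big (cubic≤cube N dv≤N)) gain-exceeds-loss)
  where
  W Z : ℕ
  W = 2 * ((s + 1) * ((2 + s) * (2 + s) + 2))
  Z = 2 * (s * ((2 + s) * D) + (2 + s) * 2)
  lhs : ∀ N K′ t s → 2 * (2 + s + 0) + 2 * (N * (2 + s) + (s * (suc K′ * ((2 + s) * (2 + s) + 2)) + t * 0 + suc K′ * ((2 + s) * (2 + s) + 2)))
      + (2 + s) * (N * N) ≡ suc K′ * (2 * ((s + 1) * ((2 + s) * (2 + s) + 2))) + (2 + s) * (N * N + 2 * N + 2)
  lhs = solve-∀
  rhs : ∀ K′ t s D → 2 * 0 + 2 * (s * ((2 + s) * (suc K′ * D)) + t * 0 + (2 + s) * (suc K′ * 2)) ≡ suc K′ * (2 * (s * ((2 + s) * D) + (2 + s) * 2))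
  rhs = solve-∀
  gain-exceeds-loss : W + 4 ≤ Z
  gain-exceeds-loss with m≤n⇒∃[o]m+o≡n 2≤s
  ... | a , refl with m≤n⇒∃[o]m+o≡n 2s+2≤D
  ... | r , refl = ≤-from-sum _ _ (identity a r)
    where
    identity : ∀ a r → let s = 2 + a in
      2 * ((s + 1) * ((2 + s) * (2 + s) + 2)) + 4 + 2 * (12 * a + 6 * a * r + 7 * a * a + a * a * r + a * a * a + 8 * r)
        ≡ 2 * (s * ((2 + s) * (2 * s + 2 + r)) + (2 + s) * 2)
    identity = solve-∀

budget-a-dv3-du≥4 : ∀ N K′ t → cube (N + 2) * 100 ≤ K′ →
  2 * (M₀ + 0) + 2 * (N * M₀ + (1 * (suc K′ * 36056) + t * 0 + (suc K′ * 36056 + M₀))) + M₀ * (N * N)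
  < 2 * 0 + 2 * (1 * (M₀ * (suc K′ * 5)) + t * 0 + suc K′ * 22360)
budget-a-dv3-du≥4 N K′ t big = subst₂ _<_ (sym (lhs M₀ K′ N t 36056)) (sym (rhs M₀ K′ t 5 22360))
  (absorb (suc K′) (4 * 36056) (M₀ * (2 * 5) + 2 * 22360) 496 (M₀ * (N * N + 2 * N + 4))
    (error-bound N K′ 495 _ big (≤-trans (≤-reflexive (*-comm M₀ _)) (*-mono-≤ (quadratic≤cube N) M₀≤49600))) budget-digits-du≥4)
  where
  lhs : ∀ M K′ N t a → 2 * (M + 0) + 2 * (N * M + (1 * (suc K′ * a) + t * 0 + (suc K′ * a + M))) + M * (N * N)
                      ≡ suc K′ * (4 * a) + M * (N * N + 2 * N + 4)
  lhs = solve-∀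
  rhs : ∀ M K′ t c b → 2 * 0 + 2 * (1 * (M * (suc K′ * c)) + t * 0 + suc K′ * b) ≡ suc K′ * (M * (2 * c) + 2 * b)
  rhs = solve-∀

budget-a-dv3-du3 : ∀ N K′ t → cube (N + 2) * 100 ≤ K′ →
  2 * (M₀ + (suc K′ * 42427 + M₀)) + 2 * (N * M₀ + (1 * (suc K′ * 36056 + M₀) + t * 0 + (suc K′ * 31623 + M₀))) + M₀ * (N * N)
  < 2 * (suc K′ * 44721) + 2 * (1 * (suc K′ * 44721) + t * 0 + suc K′ * 22360)
budget-a-dv3-du3 N K′ t big = subst₂ _<_ (sym (lhs M₀ K′ N t 42427 36056 31623)) (sym (rhs K′ t 44721 22360))
  (absorb (suc K′) (2 * 42427 + 2 * 36056 + 2 * 31623) (4 * 44721 + 2 * 22360) 3392 (M₀ * (N * N + 2 * N + 8))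
    (error-bound N K′ 3391 _ big (≤-trans (≤-reflexive (*-comm M₀ _)) (*-mono-≤ (quadratic≤cube′ N) M₀≤339200))) ≤-refl)
  where
  lhs : ∀ M K′ N t a b c → 2 * (M + (suc K′ * a + M)) + 2 * (N * M + (1 * (suc K′ * b + M) + t * 0 + (suc K′ * c + M))) + M * (N * N)
                          ≡ suc K′ * (2 * a + 2 * b + 2 * c) + M * (N * N + 2 * N + 8)
  lhs = solve-∀
  rhs : ∀ K′ t a b → 2 * (suc K′ * a) + 2 * (1 * (suc K′ * a) + t * 0 + suc K′ * b) ≡ suc K′ * (4 * a + 2 * b)
  rhs = solve-∀

budget-b : ∀ N K′ s t → 1 ≤ s → s + 3 ≤ suc t → suc t ≤ N → cube (N + 2) * 100 ≤ K′ →
  2 * (suc t + 0) + 2 * (N * suc t + (s * 0 + t * (suc K′ * (suc t * suc t + 2)) + suc t * (suc K′ * s))) + suc t * (N * N)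
  < 2 * 0 + 2 * (s * 0 + t * (suc t * (suc K′ * (suc t + s))) + 0)
budget-b N K′ s t 1≤s s+3≤dv dv≤N big = subst₂ _<_ (sym (lhs N K′ s t)) (sym (rhs K′ s t))
  (absorb (suc K′) W Z 4 (suc t * (N * N + 2 * N + 2)) (error-bound N K′ 3 _ big (cubic≤cube N dv≤N)) gain-exceeds-loss)
  where
  W Z : ℕ
  W = 2 * (t * (suc t * suc t + 2) + suc t * s)
  Z = 2 * (t * (suc t * (suc t + s)))
  lhs : ∀ N K′ s t → 2 * (suc t + 0) + 2 * (N * suc t + (s * 0 + t * (suc K′ * (suc t * suc t + 2)) + suc t * (suc K′ * s))) + suc t * (N * N)
                    ≡ suc K′ * (2 * (t * (suc t * suc t + 2) + suc t * s)) + suc t * (N * N + 2 * N + 2)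
  lhs = solve-∀
  rhs : ∀ K′ s t → 2 * 0 + 2 * (s * 0 + t * (suc t * (suc K′ * (suc t + s))) + 0) ≡ suc K′ * (2 * (t * (suc t * (suc t + s))))
  rhs = solve-∀
  gain-exceeds-loss : W + 4 ≤ Z
  gain-exceeds-loss with m≤n⇒∃[o]m+o≡n 1≤s
  ... | a , refl with m≤n⇒∃[o]m+o≡n (≤-pred (subst (_≤ suc t) (+-comm (1 + a) 3) s+3≤dv))
  ... | b , refl = ≤-from-sum _ _ (identity a b)
    where
    identity : ∀ a b → let s = 1 + a in let t = 2 + s + b in
      2 * (t * (suc t * suc t + 2) + suc t * s) + 4
        + 2 * (12 * a + 8 * a * b + a * b * b + 7 * a * a + 2 * a * a * b + a * a * a + 4 * b + b * b)
      ≡ 2 * (t * (suc t * (suc t + s)))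
    identity = solve-∀

module PartA {N} (G : Graph N) (u v v₁ : Fin N) (G* : Graph N)
  (G*-adj : ∀ a b → adj G* a b ≡ specA G u v v₁ a b)
  (u~v : adj G u v ≡ true) (v~v₁ : adj G v v₁ ≡ true) (v₁≢u : v₁ ≢ u)
  (no-triangle : ∀ {w} → adj G v w ≡ true → adj G u w ≡ true → ⊥)
  (path-degrees : ∀ {w} → adj G v w ≡ true → w ≢ u → deg G w ≤ 2)
  where

  open Transfer G v u v₁ (isVi G u v v₁) (λ _ → refl) (adj-sym G u~v) v~v₁ v₁≢u no-triangle G* G*-adj

  K′ : ℕ
  K′ = cube (N + 2) * 100

  module _ (s t : ℕ) (|S|≡s : |S| ≡ s) (|R|≡t : |R| ≡ t) where

    D : ℕ
    D = suc t + s

    kept-mono : ∀ M {b} → M * ⌊ suc K′ √ (suc t * suc t + deg G b * deg G b) ⌋ + 0 ≤ M * ⌊ suc K′ √ (D * D + deg G b * deg G b) ⌋ + 0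
    kept-mono M {b} = ⌊√⌋-scaled-mono (suc K′) M (square-+-mono (deg G b * deg G b) (m≤m+n (suc t) s))

    dv≥4 : 2 ≤ s → 2 + s ≤ suc t → SO< G G*
    dv≥4 2≤s dv≤du = SO<-transfer {K′} {suc s} |S|≡s |R|≡t record
      { g-moved = (2 + s) * (suc K′ * D) ; h-moved = suc K′ * ((2 + s) * (2 + s) + 2)
      ; g-kept = 0 ; h-kept = 0
      ; g-z = (2 + s) * (suc K′ * 2) ; h-z = suc K′ * ((2 + s) * (2 + s) + 2)
      ; g-pq = 0 ; h-pq = 0
      ; moved = λ {b} v~b b≢u _ → root-gain (suc K′) (2 + s) D (deg G b) (path-degrees v~b b≢u)
      ; kept = λ _ _ → kept-mono (2 + s)
      ; z-edge = root-gain (suc K′) (2 + s) 2 (deg G v₁) (path-degrees v~v₁ v₁≢u)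
      ; pq-edge = ⌊√⌋-scaled-mono (suc K′) (2 + s) (radicand-pq s (suc t) (≤-trans (s≤s (s≤s z≤n)) dv≤du))
      ; budget = budget-a-dv≥4 N K′ t s D 2≤s (subst (_≤ D) (reorder s) (+-monoˡ-≤ s dv≤du)) dv≤N ≤-refl
      }
      where
      reorder : ∀ s → 2 + s + s ≡ 2 * s + 2
      reorder = solve-∀
      dv≤N : 2 + s ≤ N
      dv≤N = subst (_≤ N) (trans deg-p (cong (2 +_) |S|≡s)) (deg≤n G v)

    dv3-du≥4 : s ≡ 1 → 4 ≤ suc t → SO< G G*
    dv3-du≥4 refl 4≤du = SO<-transfer {K′} {M₀′} |S|≡s |R|≡t record
      { g-moved = M₀ * (suc K′ * 5) ; h-moved = suc K′ * 36056
      ; g-kept = 0 ; h-kept = 0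
      ; g-z = suc K′ * 22360 ; h-z = suc K′ * 36056 + M₀
      ; g-pq = 0 ; h-pq = 0
      ; moved = λ {b} v~b b≢u _ → moved-gain-dv3 (suc K′) D (deg G b) (s≤s (subst (4 ≤_) (+-comm 1 t) 4≤du)) (path-degrees v~b b≢u)
      ; kept = λ _ _ → kept-mono M₀
      ; z-edge = z-loss-dv3 (suc K′) (deg G v₁) (deg≥1 G (adj-sym G v~v₁)) (path-degrees v~v₁ v₁≢u)
      ; pq-edge = ⌊√⌋-scaled-mono (suc K′) M₀ (radicand-pq 1 (suc t) (≤-trans (s≤s (s≤s z≤n)) 4≤du))
      ; budget = budget-a-dv3-du≥4 N K′ t ≤-refl
      }

    dv3-du3 : s ≡ 1 → t ≡ 2 → SO< G G*
    dv3-du3 refl refl = SO<-transfer {K′} {M₀′} |S|≡s |R|≡t record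
      { g-moved = suc K′ * 44721 ; h-moved = suc K′ * 36056 + M₀
      ; g-kept = 0 ; h-kept = 0
      ; g-z = suc K′ * 22360 ; h-z = suc K′ * 31623 + M₀
      ; g-pq = suc K′ * 44721 ; h-pq = suc K′ * 42427 + M₀
      ; moved = λ {b} v~b b≢u _ → moved-gain-dv3-D4 (suc K′) (deg G b) (deg≥1 G (adj-sym G v~b)) (path-degrees v~b b≢u)
      ; kept = λ _ _ → kept-mono M₀
      ; z-edge = z-loss-dv3-du3 (suc K′) (deg G v₁) (deg≥1 G (adj-sym G v~v₁)) (path-degrees v~v₁ v₁≢u)
      ; pq-edge = pq-gain-dv3-du3 (suc K′)
      ; budget = budget-a-dv3-du3 N K′ 2 ≤-refl
      }

  |S|≡1 : ¬ 2 ≤ |S| → 3 ≤ deg G v → |S| ≡ 1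
  |S|≡1 2≰s 3≤dv = ≤-antisym (≤-pred (≰⇒> 2≰s)) (≤-pred (≤-pred (subst (3 ≤_) deg-p 3≤dv)))

  SO-increases : deg G v ≤ deg G u → 3 ≤ deg G v → SO< G G*
  SO-increases dv≤du 3≤dv with 2 ≤? |S| | 4 ≤? suc |R|
  ... | yes 2≤s | _        = dv≥4 |S| |R| refl refl 2≤s (subst₂ _≤_ deg-p deg-q dv≤du)
  ... | no 2≰s  | yes 4≤du = dv3-du≥4 |S| |R| refl refl (|S|≡1 2≰s 3≤dv) 4≤du
  ... | no 2≰s  | no 4≰du  = dv3-du3 |S| |R| refl refl (|S|≡1 2≰s 3≤dv) |R|≡2
    where
    |R|≡2 : |R| ≡ 2
    |R|≡2 = ≤-antisym (≤-pred (≤-pred (≰⇒> 4≰du)))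
                      (≤-pred (subst₂ _≤_ (trans deg-p (cong (2 +_) (|S|≡1 2≰s 3≤dv))) deg-q dv≤du))

module PartB {N} (G : Graph N) (u v y : Fin N) (G* : Graph N)
  (G*-adj : ∀ a b → adj G* a b ≡ specB G u v y a b)
  (u~v : adj G u v ≡ true) (u~y : adj G u y ≡ true) (y≢v : y ≢ v)
  (no-triangle : ∀ {w} → adj G v w ≡ true → adj G u w ≡ true → ⊥)
  (path-degrees : ∀ {w} → adj G v w ≡ true → w ≢ u → deg G w ≤ 2)
  where

  open Transfer G u v y (isUx G u v y) (λ b → cong (adj G u b ∧_) (∧-comm (not (b == y)) (not (b == v))))
    u~v u~y y≢v (λ u~w v~w → no-triangle v~w u~w) G* G*-adj

  K′ : ℕ
  K′ = cube (N + 2) * 100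

  certified : ∀ s t → |S| ≡ s → |R| ≡ t → 1 ≤ s → s + 3 ≤ suc t → SO< G G*
  certified s t |S|≡s |R|≡t 1≤s s+3≤dv = SO<-transfer {K′} {t} |S|≡s |R|≡t record
    { g-moved = 0 ; h-moved = 0
    ; g-kept = suc t * (suc K′ * D) ; h-kept = suc K′ * (suc t * suc t + 2)
    ; g-z = 0 ; h-z = suc t * (suc K′ * s)
    ; g-pq = 0 ; h-pq = 0
    ; moved = λ {b} _ _ _ → ⌊√⌋-scaled-mono (suc K′) (suc t) (square-+-mono (deg G b * deg G b) du≤D)
    ; kept = λ {b} v~b b≢u → root-gain (suc K′) (suc t) D (deg G b) (path-degrees v~b b≢u)
    ; z-edge = root-shift (suc K′) (suc t) s (deg G y * deg G y)
    ; pq-edge = ⌊√⌋-scaled-mono (suc K′) (suc t) (radicand-pq s (suc t) (≤-trans (m≤m+n 2 s) du≤dv))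
    ; budget = budget-b N K′ s t 1≤s s+3≤dv dv≤N ≤-refl
    }
    where
    D : ℕ
    D = suc t + s
    du≤dv : 2 + s ≤ suc t
    du≤dv = ≤-trans (n≤1+n (2 + s)) (subst (_≤ suc t) (+-comm s 3) s+3≤dv)
    du≤D : 2 + s ≤ D
    du≤D = ≤-trans du≤dv (m≤m+n (suc t) s)
    dv≤N : suc t ≤ N
    dv≤N = subst (_≤ N) (trans deg-q (cong suc |R|≡t)) (deg≤n G v)

  SO-increases : (x : Fin N) → adj G u x ≡ true → x ≢ y → x ≢ v → deg G u < deg G v → SO< G G*
  SO-increases x u~x x≢y x≢v du<dv = certified |S| |R| refl refl 1≤s s+3≤dv
    where
    x∈S : isUx G u v y x ≡ true
    x∈S rewrite u~x | ==-≢ x≢y | ==-≢ x≢v = refl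
    1≤s : 1 ≤ |S|
    1≤s = subst (_≤ |S|) (cong b2n x∈S) (term≤∑ (λ b → b2n (isUx G u v y b)) x)
    s+3≤dv : |S| + 3 ≤ suc |R|
    s+3≤dv = subst₂ _≤_ (+-comm 3 |S|) deg-q (subst (_< deg G v) deg-p du<dv)

lemma3p4 : (N k : ℕ) (G : Graph N) (L : ℕ) (c : Fin L → Fin N) → InU N k G L c →
    (i : Fin L) (x u y v : Fin N) → c i ≡ x → c (next i) ≡ u → c (next (next i)) ≡ y →
    (∀ j → c j ≢ v) → adj G u v ≡ true → 3 ≤ deg G v →
    (∀ w → Reach (delEdge G u v) v w → w ≢ v → deg G w ≤ 2) →
    ((deg G v ≤ deg G u → (v₁ : Fin N) → adj G v v₁ ≡ true → v₁ ≢ u →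
        (G* : Graph N) → (∀ a b → adj G* a b ≡ specA G u v v₁ a b) → SO< G G*)
     × (deg G u < deg G v →
        (G* : Graph N) → (∀ a b → adj G* a b ≡ specB G u v y a b) → SO< G G*))
lemma3p4 N k G L c (unicyclic , _) i x u y v cᵢ≡x cᵢ₊₁≡u cᵢ₊₂≡y v∉C u~v 3≤dv tree =
  (λ dv≤du v₁ v~v₁ v₁≢u G* G*-adj →
    PartA.SO-increases G u v v₁ G* G*-adj u~v v~v₁ v₁≢u no-triangle path-degrees dv≤du 3≤dv) ,
  (λ du<dv G* G*-adj →
    PartB.SO-increases G u v y G* G*-adj u~v u~y y≢v no-triangle path-degrees x u~x x≢y x≢v du<dv)
  where
  cycle : IsCycle G L c
  cycle = proj₁ (proj₂ unicyclic)
  no-triangle : ∀ {w} → adj G v w ≡ true → adj G u w ≡ true → ⊥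
  no-triangle v~w u~w = no-triangle-off-cycle unicyclic v∉C u~v v~w u~w
  path-degrees : ∀ {w} → adj G v w ≡ true → w ≢ u → deg G w ≤ 2
  path-degrees v~w w≢u = tree _ (reach-neighbour G u~v v~w w≢u) (λ w≡v → adj⇒≢ G v~w (sym w≡v))
  u~y : adj G u y ≡ true
  u~y = subst₂ (λ a b → adj G a b ≡ true) cᵢ₊₁≡u cᵢ₊₂≡y (IsCycle.closed cycle (next i))
  u~x : adj G u x ≡ true
  u~x = adj-sym G (subst₂ (λ a b → adj G a b ≡ true) cᵢ≡x cᵢ₊₁≡u (IsCycle.closed cycle i))
  y≢v : y ≢ v
  y≢v y≡v = v∉C (next (next i)) (trans cᵢ₊₂≡y y≡v)
  x≢v : x ≢ v
  x≢v x≡v = v∉C i (trans cᵢ≡x x≡v)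
  x≢y : x ≢ y
  x≢y x≡y = next²≢id (IsCycle.len≥3 cycle) i (sym (IsCycle.distinct cycle (trans cᵢ≡x (trans x≡y (sym cᵢ₊₂≡y)))))
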